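{- The operators $\mathscr{D}_n$ ($n\in\mathbb{N}$) on $\tilde{\mathcal R}$ commute pairwise: $[\mathscr D_n,\mathscr D_m]=0$ for all $n,m$.
   Context: Let $\mathcal{R}=\mathbb{Q}[Q_1,Q_2,Q_3,\ldots]$ be a polynomial algebra and $\tilde{\mathcal R}=\mathcal R[Q_2^{ -1/2}]$; set $Q_0:=1$ and let partial derivatives in the variables $Q_1,Q_2,\ldots$ act on $\tilde{\mathcal R}$ in the usual way (with $\frac{\partial}{\partial Q_2}Q_2^s=sQ_2^{s-1}$). For $\vec i=(i_1,\ldots,i_n)\in\mathbb{Z}_{\ge0}^n$ put $|\vec i|=i_1+\cdots+i_n$ and $\partial_{\vec i}=\frac{\partial^n}{\partial Q_{i_1+1}\partial Q_{i_2+1}\cdots\partial Q_{i_n+1}}$, and define $$\mathscr D_n=\sum_{\vec i\in\mathbb{Z}_{\ge0}^n}\binom{|\vec i|}{i_1,i_2,\ldots,i_n}Q_{|\vec i|}\,\partial_{\vec i},$$ with a multinomial coefficient (only finitely many terms act nontrivially on any given element). -}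

module Defs where

open import Data.Nat as ℕ using (ℕ; zero; suc; _∸_; _⊔_)
open import Data.Nat.Combinatorics using (_C_)
open import Data.Integer as ℤ using (ℤ; +_)
open import Data.Rational as ℚ using (ℚ; 0ℚ; 1ℚ)
open import Data.List using (List; []; _∷_; map; concatMap; upTo; foldr; length; replicate; _++_)
open import Data.Product using (_×_; _,_)
open import Data.Bool using (Bool; true; false; _∧_; if_then_else_)

-- The algebra  R~ = Q[Q_1,Q_2,Q_3,...][Q_2^{-1/2}].
-- A monomial  Q_2^{h/2} * Q_1^{a_0} * Q_3^{a_1} * Q_4^{a_2} * ...
-- is represented by  h : ℤ  (twice the exponent of Q_2) and the list
-- [a_0, a_1, a_2, ...] of natural exponents of Q_1, Q_3, Q_4, ...
-- (list position 0 <-> Q_1, position j >= 1 <-> Q_{j+2});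
-- missing trailing entries mean exponent 0.

record Mono : Set where
  constructor mono
  field
    half2 : ℤ
    exps  : List ℕ
open Mono public

Poly : Set
Poly = List (ℚ × Mono)

isZeros : List ℕ → Bool
isZeros []            = true
isZeros (zero  ∷ xs)  = isZeros xs
isZeros (suc _ ∷ _)   = false

eqExps : List ℕ → List ℕ → Bool
eqExps []       ys       = isZeros ys
eqExps xs       []       = isZeros xs
eqExps (x ∷ xs) (y ∷ ys) = (x ℕ.≡ᵇ y) ∧ eqExps xs ys

eqℤ : ℤ → ℤ → Bool
eqℤ (+ m)      (+ n)      = m ℕ.≡ᵇ n
eqℤ ℤ.-[1+ m ] ℤ.-[1+ n ] = m ℕ.≡ᵇ n
eqℤ _          _          = false

eqMono : Mono → Mono → Bool
eqMono (mono h xs) (mono k ys) = eqℤ h k ∧ eqExps xs ys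

coeff : Poly → Mono → ℚ
coeff []             m = 0ℚ
coeff ((c , m') ∷ p) m = (if eqMono m m' then c else 0ℚ) ℚ.+ coeff p m

infix 4 _≈_
_≈_ : Poly → Poly → Set
p ≈ q = ∀ m → coeff p m ≡ coeff q m
  where open import Relation.Binary.PropositionalEquality using (_≡_)

zipAdd : List ℕ → List ℕ → List ℕ
zipAdd []       ys       = ys
zipAdd xs       []       = xs
zipAdd (x ∷ xs) (y ∷ ys) = (x ℕ.+ y) ∷ zipAdd xs ys

mulMono : Mono → Mono → Mono
mulMono (mono h xs) (mono k ys) = mono (h ℤ.+ k) (zipAdd xs ys)

_*ᴾ_ : Poly → Poly → Poly
p *ᴾ q = concatMap (λ { (c , m) → map (λ { (d , n) → (c ℚ.* d , mulMono m n) }) q }) p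

scale : ℚ → Poly → Poly
scale c = map (λ { (d , m) → (c ℚ.* d , m) })

-- the generator Q_k (with Q_0 = 1)
Qv : ℕ → Poly
Qv zero                = (1ℚ , mono (+ 0) []) ∷ []
Qv (suc zero)          = (1ℚ , mono (+ 0) (1 ∷ [])) ∷ []
Qv (suc (suc zero))    = (1ℚ , mono (+ 2) []) ∷ []
Qv (suc (suc (suc j))) = (1ℚ , mono (+ 0) (replicate (suc j) 0 ++ (1 ∷ []))) ∷ []

dList : ℕ → List ℕ → ℕ × List ℕ
dList j        []       = 0 , []
dList zero     (a ∷ xs) = a , ((a ∸ 1) ∷ xs)
dList (suc j)  (a ∷ xs) with dList j xs
... | c , ys = c , (a ∷ ys)

dMono : ℕ → Mono → ℚ × Mono
dMono zero          m           = 0ℚ , m     -- no variable Q_0 (Q_0 = 1 is a constant)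
dMono (suc zero)    (mono h xs) with dList 0 xs
... | c , ys = (+ c ℚ./ 1) , mono h ys
dMono (suc (suc zero)) (mono h xs) = (h ℚ./ 2) , mono (h ℤ.- + 2) xs
  -- d/dQ_2 Q_2^{h/2} = (h/2) Q_2^{(h-2)/2}
dMono (suc (suc (suc j))) (mono h xs) with dList (suc j) xs
... | c , ys = (+ c ℚ./ 1) , mono h ys

∂ : ℕ → Poly → Poly
∂ k = map (λ { (c , m) → let r = dMono k m in (c ℚ.* Data.Product.proj₁ r , Data.Product.proj₂ r) })
  where import Data.Product

-- ∂_{i} = ∂/∂Q_{i_1+1} ... ∂/∂Q_{i_n+1}
∂vec : List ℕ → Poly → Poly
∂vec []       p = p
∂vec (i ∷ is) p = ∂ (suc i) (∂vec is p)

sumℕ : List ℕ → ℕ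
sumℕ = foldr ℕ._+_ 0

multinom : List ℕ → ℕ
multinom []       = 1
multinom (i ∷ is) = ((i ℕ.+ sumℕ is) C i) ℕ.* multinom is

tuples : ℕ → ℕ → List (List ℕ)
tuples zero    N = [] ∷ []
tuples (suc n) N = concatMap (λ i → map (i ∷_) (tuples n N)) (upTo N)

-- every variable Q_k occurring in p has k < bound p, so ∂/∂Q_{i+1} p = 0
-- whenever i >= bound p; hence all terms of D_n with some i_j >= bound p
-- vanish and the defining sum may be truncated there.
bound : Poly → ℕ
bound = foldr (λ { (_ , mono _ xs) b → (length xs ℕ.+ 3) ⊔ b }) 3

𝒟 : ℕ → Poly → Poly
𝒟 n p = concatMap
  (λ is → scale (+ multinom is ℚ./ 1) (Qv (sumℕ is) *ᴾ ∂vec is p))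
  (tuples n (bound p))

module Submission where

-- A polynomial is handled through its coefficient series on monomials, on which ∂_i = ∂/∂Q_i and multiplication by Q_i
-- act as linear operators with [∂_i, ∂_j] = [Q_i, Q_j] = 0 and [∂_i, Q_j] = δ_ij. Writing 𝐋(t) = Σᵢ tⁱ/i! ∂_{i+1},
-- one has 𝒟 n = Σ_k Q_k ℒ n k with ℒ n k = k! [tᵏ] 𝐋(t)ⁿ, hence
--   𝒟 n 𝒟 m = Σ_{k,l} Q_k Q_l ℒ n k ℒ m l + Σ_{k,l} Q_k [ℒ n k, Q_l] ℒ m l.
-- The first sum is symmetric in n and m. Since [ℒ n k, Q_{l+1}] = n (k C l) ℒ (n - 1) (k ∸ l), the inner sum of the
-- second one is n m k! [tᵏ] 𝐋ⁿ⁺ᵐ⁻² 𝐋′, symmetric as well. All sums are finite because a polynomial involves only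
-- finitely many variables.

open import Level using (0ℓ)
open import Algebra.Bundles using (CommutativeMonoid)
open import Data.Nat as ℕ using (ℕ; zero; suc; _+_; _*_; _∸_; _≤_; _<_; z≤n; s≤s; _!)
import Data.Nat.Properties as ℕₚ
open ℕₚ using (0≢1+n; _!≢0; _!*_!≢0)
open import Data.Nat.Combinatorics using (_C_; nCk≡n!/k![n-k]!; k![n∸k]!∣n!; k>n⇒nCk≡0; nCk≡nC[n∸k]; nCn≡1; nCk+nC[k+1]≡[n+1]C[k+1])
open import Data.Nat.DivMod using (m/n*n≡m)
import Data.Nat.Coprimality as Coprime
open import Data.Integer as ℤ using (ℤ; +_)
import Data.Integer.Properties as ℤₚ
import Data.Integer.GCD as ℤGCD
import Data.Integer.Solver
import Data.Nat.Solver
import Data.Rational.Solver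
open import Data.Rational as ℚ using (ℚ; 0ℚ; 1ℚ; mkℚ)
import Data.Rational.Properties as ℚₚ
import Data.Rational.Unnormalised as ℚᵘ
import Data.Rational.Unnormalised.Properties as ℚᵘₚ
open import Data.List using (List; []; _∷_; map; concatMap; upTo; applyUpTo; replicate; length; _++_)
open import Data.Sum using (inj₁; inj₂)
open import Data.Product using (_×_; _,_; proj₁; proj₂)
open import Data.Bool using (T; true; false; if_then_else_)
open import Data.Bool.Properties using (T-∧)
open import Function.Bundles using (module Equivalence)
open import Function using (_∘_; id)
open import Relation.Binary.PropositionalEquality as ≡ using (_≡_; _≢_)
import Relation.Binary.Reasoning.Setoid
open import Relation.Nullary using (¬_; yes; no; contradiction)
open import Relation.Nullary.Reflects using (Reflects; ofʸ; ofⁿ; fromEquivalence)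

module ℤSolver = Data.Integer.Solver.+-*-Solver
module ℕSolver = Data.Nat.Solver.+-*-Solver
module ℚSolver = Data.Rational.Solver.+-*-Solver

1+m≤o∸i : ∀ {i n m o} → i < n → n + m < o → suc m ≤ o ∸ i
1+m≤o∸i {i} {n} {m} {o} i<n n+m<o = ℕₚ.m+n≤o⇒m≤o∸n (suc m) (begin
  suc m + i  ≡⟨ ℕₚ.+-comm (suc m) i ⟩
  i + suc m  ≡⟨ ℕₚ.+-suc i m ⟩
  suc i + m  ≤⟨ ℕₚ.+-monoˡ-≤ m i<n ⟩
  n + m      ≤⟨ ℕₚ.<⇒≤ n+m<o ⟩
  o          ∎)
  where open ℕₚ.≤-Reasoning

module FiniteSums {c ℓ} (M : CommutativeMonoid c ℓ) where

  open CommutativeMonoid M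
  open import Algebra.Properties.CommutativeSemigroup commutativeSemigroup using (interchange)
  open import Relation.Binary.Reasoning.Setoid setoid

  ∑ : ∀ {a} {A : Set a} → List A → (A → Carrier) → Carrier
  ∑ []       f = ε
  ∑ (x ∷ xs) f = f x ∙ ∑ xs f

  ∑< : ℕ → (ℕ → Carrier) → Carrier
  ∑< zero    f = ε
  ∑< (suc n) f = ∑< n f ∙ f n

  ∑-cong : ∀ {a} {A : Set a} (xs : List A) {f g : A → Carrier} → (∀ x → f x ≈ g x) → ∑ xs f ≈ ∑ xs g
  ∑-cong []       f≈g = refl
  ∑-cong (x ∷ xs) f≈g = ∙-cong (f≈g x) (∑-cong xs f≈g)

  ∑-++ : ∀ {a} {A : Set a} (xs ys : List A) (f : A → Carrier) → ∑ (xs ++ ys) f ≈ ∑ xs f ∙ ∑ ys f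
  ∑-++ []       ys f = sym (identityˡ _)
  ∑-++ (x ∷ xs) ys f = trans (∙-congˡ (∑-++ xs ys f)) (sym (assoc _ _ _))

  ∑-map : ∀ {a b} {A : Set a} {B : Set b} (g : A → B) (xs : List A) (f : B → Carrier) →
          ∑ (map g xs) f ≈ ∑ xs (f ∘ g)
  ∑-map g []       f = refl
  ∑-map g (x ∷ xs) f = ∙-congˡ (∑-map g xs f)

  ∑-concatMap : ∀ {a b} {A : Set a} {B : Set b} (g : A → List B) (xs : List A) (f : B → Carrier) →
                ∑ (concatMap g xs) f ≈ ∑ xs (λ x → ∑ (g x) f)
  ∑-concatMap g []       f = refl
  ∑-concatMap g (x ∷ xs) f = trans (∑-++ (g x) (concatMap g xs) f) (∙-congˡ (∑-concatMap g xs f))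

  ∑<-cong-< : ∀ n {f g : ℕ → Carrier} → (∀ i → i < n → f i ≈ g i) → ∑< n f ≈ ∑< n g
  ∑<-cong-< zero    f≈g = refl
  ∑<-cong-< (suc n) f≈g = ∙-cong (∑<-cong-< n (λ i i<n → f≈g i (ℕₚ.m<n⇒m<1+n i<n))) (f≈g n ℕₚ.≤-refl)

  ∑<-cong : ∀ n {f g : ℕ → Carrier} → (∀ i → f i ≈ g i) → ∑< n f ≈ ∑< n g
  ∑<-cong n f≈g = ∑<-cong-< n (λ i _ → f≈g i)

  ∑<-zero : ∀ n {f : ℕ → Carrier} → (∀ i → i < n → f i ≈ ε) → ∑< n f ≈ ε
  ∑<-zero zero    f≈ε = refl
  ∑<-zero (suc n) f≈ε =
    trans (∙-cong (∑<-zero n (λ i i<n → f≈ε i (ℕₚ.m<n⇒m<1+n i<n))) (f≈ε n ℕₚ.≤-refl)) (identityˡ ε)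

  ∑<-distrib : ∀ n (f g : ℕ → Carrier) → ∑< n (λ i → f i ∙ g i) ≈ ∑< n f ∙ ∑< n g
  ∑<-distrib zero    f g = sym (identityˡ ε)
  ∑<-distrib (suc n) f g = trans (∙-congʳ (∑<-distrib n f g)) (interchange _ _ (f n) (g n))

  ∑<-comm : ∀ m n (f : ℕ → ℕ → Carrier) → ∑< m (λ i → ∑< n (f i)) ≈ ∑< n (λ j → ∑< m (λ i → f i j))
  ∑<-comm zero    n f = sym (∑<-zero n (λ _ _ → refl))
  ∑<-comm (suc m) n f = trans (∙-congʳ (∑<-comm m n f)) (sym (∑<-distrib n _ (f m)))

  ∑<-suc : ∀ n (f : ℕ → Carrier) → ∑< (suc n) f ≈ f 0 ∙ ∑< n (f ∘ suc)
  ∑<-suc zero    f = trans (identityˡ (f 0)) (sym (identityʳ (f 0)))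
  ∑<-suc (suc n) f = trans (∙-congʳ (∑<-suc n f)) (assoc (f 0) _ _)

  ∑-upTo : ∀ n (f : ℕ → Carrier) → ∑ (upTo n) f ≈ ∑< n f
  ∑-upTo n f = ∑-applyUpTo n id
    where
    ∑-applyUpTo : ∀ n g → ∑ (applyUpTo g n) f ≈ ∑< n (f ∘ g)
    ∑-applyUpTo zero    g = refl
    ∑-applyUpTo (suc n) g = trans (∙-congˡ (∑-applyUpTo n (g ∘ suc))) (sym (∑<-suc n (f ∘ g)))

  ∑<-truncate : ∀ {m n} (f : ℕ → Carrier) → (∀ i → m ≤ i → f i ≈ ε) → m ≤ n → ∑< n f ≈ ∑< m f
  ∑<-truncate {n = zero}  f f≈ε z≤n = refl
  ∑<-truncate {n = suc n} f f≈ε m≤1+n with ℕₚ.m≤n⇒m<n∨m≡n m≤1+n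
  ... | inj₁ m<1+n = trans (∙-cong (∑<-truncate f f≈ε (ℕₚ.≤-pred m<1+n)) (f≈ε n (ℕₚ.≤-pred m<1+n))) (identityʳ _)
  ... | inj₂ ≡.refl = refl

  ∑<-extend : ∀ {m} n n' (f : ℕ → Carrier) → (∀ i → m ≤ i → f i ≈ ε) → m ≤ n → m ≤ n' → ∑< n f ≈ ∑< n' f
  ∑<-extend n n' f f≈ε m≤n m≤n' = trans (∑<-truncate f f≈ε m≤n) (sym (∑<-truncate f f≈ε m≤n'))

  ∑<-resize : ∀ m n (f : ℕ → Carrier) → (∀ i → m ≤ i → f i ≈ ε) → (∀ i → n ≤ i → f i ≈ ε) →
               ∑< m f ≈ ∑< n f
  ∑<-resize m n f f≈ε₁ f≈ε₂ with ℕₚ.≤-total m n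
  ... | inj₁ m≤n = sym (∑<-truncate f f≈ε₁ m≤n)
  ... | inj₂ n≤m = ∑<-truncate f f≈ε₂ n≤m

  ∑<-delta : ∀ n k (f : ℕ → Carrier) → (∀ i → i < n → i ≢ k → f i ≈ ε) → (n ≤ k → f k ≈ ε) → ∑< n f ≈ f k
  ∑<-delta zero    k f off out = sym (out z≤n)
  ∑<-delta (suc n) k f off out with n ℕ.≟ k
  ... | yes ≡.refl = trans (∙-congʳ (∑<-zero n (λ i i<n → off i (ℕₚ.m<n⇒m<1+n i<n) (ℕₚ.<⇒≢ i<n)))) (identityˡ (f n))
  ... | no n≢k   = trans (∙-cong rest (off n ℕₚ.≤-refl n≢k)) (identityʳ (f k))
    where
    rest : ∑< n f ≈ f k
    rest = ∑<-delta n k f (λ i i<n → off i (ℕₚ.m<n⇒m<1+n i<n)) (λ n≤k → out (ℕₚ.≤∧≢⇒< n≤k n≢k))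

  ∑<-triangle : ∀ k (g : ℕ → ℕ → Carrier) →
                ∑< (suc k) (λ j → ∑< (suc j) (g j)) ≈ ∑< (suc k) (λ i → ∑< (suc (k ∸ i)) (λ j → g (i + j) i))
  ∑<-triangle zero    g = refl
  ∑<-triangle (suc k) g = begin
    ∑< (suc k) (λ j → ∑< (suc j) (g j)) ∙ (∑< (suc k) (g (suc k)) ∙ g (suc k) (suc k))
      ≈⟨ ∙-congʳ (∑<-triangle k g) ⟩
    ∑< (suc k) (λ i → ∑< (suc (k ∸ i)) (λ j → g (i + j) i)) ∙ (∑< (suc k) (g (suc k)) ∙ g (suc k) (suc k))
      ≈⟨ sym (assoc _ _ _) ⟩
    (∑< (suc k) (λ i → ∑< (suc (k ∸ i)) (λ j → g (i + j) i)) ∙ ∑< (suc k) (g (suc k))) ∙ g (suc k) (suc k)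
      ≈⟨ ∙-cong (trans (sym (∑<-distrib (suc k) _ _)) (∑<-cong-< (suc k) column)) corner ⟩
    ∑< (suc k) (λ i → ∑< (suc (suc k ∸ i)) (λ j → g (i + j) i)) ∙ ∑< (suc (suc k ∸ suc k)) (λ j → g (suc k + j) (suc k))
      ∎
    where
    column : ∀ i → i < suc k →
             ∑< (suc (k ∸ i)) (λ j → g (i + j) i) ∙ g (suc k) i ≈ ∑< (suc (suc k ∸ i)) (λ j → g (i + j) i)
    column i (s≤s i≤k) rewrite ℕₚ.+-∸-assoc 1 i≤k | ℕₚ.+-suc i (k ∸ i) | ℕₚ.m+[n∸m]≡n i≤k = refl
    corner : g (suc k) (suc k) ≈ ∑< (suc (suc k ∸ suc k)) (λ j → g (suc k + j) (suc k))
    corner rewrite ℕₚ.n∸n≡0 k | ℕₚ.+-identityʳ k = sym (identityˡ _)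

  ∑<-comm-simplex : ∀ k (h : ℕ → ℕ → Carrier) →
                    (∀ i j → k ∸ i < j → h i j ≈ ε) → (∀ i j → k ∸ j < i → h i j ≈ ε) →
                    ∑< (suc k) (λ i → ∑< (suc (k ∸ i)) (h i)) ≈ ∑< (suc k) (λ j → ∑< (suc (k ∸ j)) (λ i → h i j))
  ∑<-comm-simplex k h h₁≈ε h₂≈ε = begin
    ∑< (suc k) (λ i → ∑< (suc (k ∸ i)) (h i))
      ≈⟨ ∑<-cong (suc k) (λ i → ∑<-extend (suc (k ∸ i)) (suc k) (h i) (h₁≈ε i) ℕₚ.≤-refl (s≤s (ℕₚ.m∸n≤m k i))) ⟩
    ∑< (suc k) (λ i → ∑< (suc k) (h i))
      ≈⟨ ∑<-comm (suc k) (suc k) h ⟩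
    ∑< (suc k) (λ j → ∑< (suc k) (λ i → h i j))
      ≈⟨ ∑<-cong (suc k) (λ j → ∑<-extend (suc k) (suc (k ∸ j)) _ (λ i → h₂≈ε i j) (s≤s (ℕₚ.m∸n≤m k j)) ℕₚ.≤-refl) ⟩
    ∑< (suc k) (λ j → ∑< (suc (k ∸ j)) (λ i → h i j))
      ∎

  ∑<-support-box : ∀ {K L N M} (f : ℕ → ℕ → Carrier) →
                   (∀ i j → N ≤ i → f i j ≈ ε) → (∀ i j → M < j → f i j ≈ ε) →
                   N ≤ K → N + M < L → ∑< K (λ i → ∑< L (f i)) ≈ ∑< L (λ i → ∑< (L ∸ i) (f i))
  ∑<-support-box {K} {L} {N} {M} f f₁≈ε f₂≈ε N≤K N+M<L = begin
    ∑< K (λ i → ∑< L (f i))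
      ≈⟨ ∑<-truncate _ (λ i N≤i → ∑<-zero L (λ j _ → f₁≈ε i j N≤i)) N≤K ⟩
    ∑< N (λ i → ∑< L (f i))
      ≈⟨ ∑<-cong-< N (λ i i<N → ∑<-extend L (L ∸ i) (f i) (λ j → f₂≈ε i j) 1+M≤L (1+M≤L∸i i<N)) ⟩
    ∑< N (λ i → ∑< (L ∸ i) (f i))
      ≈⟨ ∑<-truncate _ (λ i N≤i → ∑<-zero (L ∸ i) (λ j _ → f₁≈ε i j N≤i)) N≤L ⟨
    ∑< L (λ i → ∑< (L ∸ i) (f i)) ∎
    where
    N≤L : N ≤ L
    N≤L = ℕₚ.≤-trans (ℕₚ.m≤m+n N M) (ℕₚ.<⇒≤ N+M<L)
    1+M≤L : suc M ≤ L
    1+M≤L = ℕₚ.≤-trans (s≤s (ℕₚ.m≤n+m M N)) N+M<L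
    1+M≤L∸i : ∀ {i} → i < N → suc M ≤ L ∸ i
    1+M≤L∸i i<N = 1+m≤o∸i i<N N+M<L

  ∑<-homo : ∀ {h : Carrier → Carrier} →
            (∀ {x y} → x ≈ y → h x ≈ h y) → h ε ≈ ε → (∀ x y → h (x ∙ y) ≈ h x ∙ h y) →
            ∀ n f → h (∑< n f) ≈ ∑< n (h ∘ f)
  ∑<-homo h-cong h-ε h-∙ zero    f = h-ε
  ∑<-homo h-cong h-ε h-∙ (suc n) f = trans (h-∙ _ _) (∙-congʳ (∑<-homo h-cong h-ε h-∙ n f))

open import Defs
import Algebra.Properties.CommutativeSemigroup as CommSemigroupProperties
module ℚ* = CommSemigroupProperties (CommutativeMonoid.commutativeSemigroup ℚₚ.*-1-commutativeMonoid)
module ℕ* = CommSemigroupProperties ℕₚ.*-commutativeSemigroup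

-- `⟦ n ⟧` is the numeral `+ n / 1` occurring in 𝒟; it is opaque so that unification never normalises the gcd computations.
opaque
  ⟦_⟧ : ℕ → ℚ
  ⟦ n ⟧ = + n ℚ./ 1

  ⟦n⟧≡n/1 : ∀ n → ⟦ n ⟧ ≡ + n ℚ./ 1
  ⟦n⟧≡n/1 n = ≡.refl

  ⟦0⟧ : ⟦ 0 ⟧ ≡ 0ℚ
  ⟦0⟧ = ≡.refl

  ⟦1⟧ : ⟦ 1 ⟧ ≡ 1ℚ
  ⟦1⟧ = ≡.refl

  i/1≡mkℚi1 : ∀ i → i ℚ./ 1 ≡ mkℚ i 0 (Coprime.sym (Coprime.1-coprimeTo ℤ.∣ i ∣))
  i/1≡mkℚi1 (+ n)      = ℚₚ.normalize-coprime (Coprime.sym (Coprime.1-coprimeTo n))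
  i/1≡mkℚi1 ℤ.-[1+ n ] = ≡.cong ℚ.-_ (ℚₚ.normalize-coprime (Coprime.sym (Coprime.1-coprimeTo (suc n))))

  i/1+j/1≡[i+j]/1 : ∀ i j → (i ℚ./ 1) ℚ.+ (j ℚ./ 1) ≡ (i ℤ.+ j) ℚ./ 1
  i/1+j/1≡[i+j]/1 i j rewrite i/1≡mkℚi1 i | i/1≡mkℚi1 j =
    ℚₚ./-cong (≡.cong₂ ℤ._+_ (ℤₚ.*-identityʳ i) (ℤₚ.*-identityʳ j)) ≡.refl

  i/1*j/1≡[i*j]/1 : ∀ i j → (i ℚ./ 1) ℚ.* (j ℚ./ 1) ≡ (i ℤ.* j) ℚ./ 1
  i/1*j/1≡[i*j]/1 i j rewrite i/1≡mkℚi1 i | i/1≡mkℚi1 j = ≡.refl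

  ⟦⟧-+ : ∀ a b → ⟦ a + b ⟧ ≡ ⟦ a ⟧ ℚ.+ ⟦ b ⟧
  ⟦⟧-+ a b = ≡.trans (≡.cong (ℚ._/ 1) (ℤₚ.pos-+ a b)) (≡.sym (i/1+j/1≡[i+j]/1 (+ a) (+ b)))

  ⟦⟧-* : ∀ a b → ⟦ a * b ⟧ ≡ ⟦ a ⟧ ℚ.* ⟦ b ⟧
  ⟦⟧-* a b = ≡.trans (≡.cong (ℚ._/ 1) (ℤₚ.pos-* a b)) (≡.sym (i/1*j/1≡[i*j]/1 (+ a) (+ b)))

⟦suc⟧ : ∀ n → ⟦ suc n ⟧ ≡ ⟦ n ⟧ ℚ.+ 1ℚ
⟦suc⟧ n = ≡.trans (≡.cong ⟦_⟧ (ℕₚ.+-comm 1 n)) (≡.trans (⟦⟧-+ n 1) (≡.cong (⟦ n ⟧ ℚ.+_) ⟦1⟧))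

[x+1]*y≡x*y+y : ∀ x y → (x ℚ.+ 1ℚ) ℚ.* y ≡ x ℚ.* y ℚ.+ y
[x+1]*y≡x*y+y = ℚ-solve 2 (λ x y → (x :+ con 1ℚ) :* y := x :* y :+ y) ≡.refl
  where open ℚSolver using (_:*_; _:+_; _:=_; con) renaming (solve to ℚ-solve)

h+2-2≡h : ∀ h → (h ℤ.+ + 2) ℤ.- + 2 ≡ h
h+2-2≡h = ℤ-solve 1 (λ h → (h :+ con (+ 2)) :- con (+ 2) := h) ≡.refl
  where open ℤSolver using (_:+_; _:-_; _:=_; con) renaming (solve to ℤ-solve)

h-2+2≡h : ∀ h → (h ℤ.- + 2) ℤ.+ + 2 ≡ h
h-2+2≡h = ℤ-solve 1 (λ h → (h :- con (+ 2)) :+ con (+ 2) := h) ≡.refl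
  where open ℤSolver using (_:+_; _:-_; _:=_; con) renaming (solve to ℤ-solve)

toℚᵘ[i/2]≃i/2 : ∀ i → ℚ.toℚᵘ (i ℚ./ 2) ℚᵘ.≃ ℚᵘ.mkℚᵘ i 1
toℚᵘ[i/2]≃i/2 i = ℚᵘ.*≡* (begin
  ℚᵘ.↥ ℚ.toℚᵘ p ℤ.* + 2          ≡⟨ ≡.cong (ℤ._* + 2) (ℚₚ.↥ᵘ-toℚᵘ p) ⟩
  ℚ.↥ p ℤ.* + 2                   ≡⟨ ≡.cong (ℚ.↥ p ℤ.*_) (≡.sym (ℚₚ.↧-/ i 2)) ⟩
  ℚ.↥ p ℤ.* (ℚ.↧ p ℤ.* g)         ≡⟨ ℤ-solve 3 (λ a b c → a :* (b :* c) := (a :* c) :* b) ≡.refl (ℚ.↥ p) (ℚ.↧ p) g ⟩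
  (ℚ.↥ p ℤ.* g) ℤ.* ℚ.↧ p         ≡⟨ ≡.cong₂ ℤ._*_ (ℚₚ.↥-/ i 2) (≡.sym (ℚₚ.↧ᵘ-toℚᵘ p)) ⟩
  i ℤ.* ℚᵘ.↧ ℚ.toℚᵘ p             ∎)
  where
  open ≡.≡-Reasoning
  open ℤSolver using (_:*_; _:=_) renaming (solve to ℤ-solve)
  p = i ℚ./ 2
  g = ℤGCD.gcd i (+ 2)

[h+2]/2≡h/2+1 : ∀ h → (h ℤ.+ + 2) ℚ./ 2 ≡ (h ℚ./ 2) ℚ.+ 1ℚ
[h+2]/2≡h/2+1 h = ℚₚ.toℚᵘ-injective (begin
  ℚ.toℚᵘ ((h ℤ.+ + 2) ℚ./ 2)                    ≈⟨ toℚᵘ[i/2]≃i/2 (h ℤ.+ + 2) ⟩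
  ℚᵘ.mkℚᵘ (h ℤ.+ + 2) 1                          ≈⟨ ℚᵘ.*≡* (cross-multiplied h) ⟩
  ℚᵘ.mkℚᵘ h 1 ℚᵘ.+ ℚᵘ.mkℚᵘ (+ 1) 0               ≈⟨ ℚᵘₚ.+-cong (toℚᵘ[i/2]≃i/2 h) ℚᵘₚ.≃-refl ⟨
  ℚ.toℚᵘ (h ℚ./ 2) ℚᵘ.+ ℚ.toℚᵘ 1ℚ                ≈⟨ ℚᵘₚ.≃-sym (ℚₚ.toℚᵘ-homo-+ (h ℚ./ 2) 1ℚ) ⟩
  ℚ.toℚᵘ ((h ℚ./ 2) ℚ.+ 1ℚ)                       ∎)
  where
  open ℚᵘₚ.≃-Reasoning
  open ℤSolver using (_:*_; _:+_; _:=_; con) renaming (solve to ℤ-solve)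
  cross-multiplied : ∀ h → (h ℤ.+ + 2) ℤ.* + 2 ≡ (h ℤ.* + 1 ℤ.+ + 1 ℤ.* + 2) ℤ.* + 2
  cross-multiplied = ℤ-solve 1 (λ h → (h :+ con (+ 2)) :* con (+ 2) := (h :* con (+ 1) :+ con (+ 1) :* con (+ 2)) :* con (+ 2)) ≡.refl

nCk*[k!*[n∸k]!]≡n! : ∀ n k → k ≤ n → (n C k) * (k ! * (n ∸ k) !) ≡ n !
nCk*[k!*[n∸k]!]≡n! n k k≤n =
  ≡.trans (≡.cong (_* (k ! * (n ∸ k) !)) (nCk≡n!/k![n-k]! k≤n)) (m/n*n≡m {{k !* (n ∸ k) !≢0}} (k![n∸k]!∣n! k≤n))

-- Both sides count pairs of disjoint subsets of sizes i and j of an n-set: n!/(i! j! (n ∸ i ∸ j)!) if i + j ≤ n, else 0.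
nC[i+j]*[i+j]Ci≡nCi*[n∸i]Cj : ∀ n i j → (n C (i + j)) * ((i + j) C i) ≡ (n C i) * ((n ∸ i) C j)
nC[i+j]*[i+j]Ci≡nCi*[n∸i]Cj n i j with ℕₚ.≤-<-connex (i + j) n
... | inj₂ n<i+j = ≡.trans (≡.cong (_* ((i + j) C i)) (k>n⇒nCk≡0 n<i+j)) (≡.sym rhs≡0)
  where
  rhs≡0 : (n C i) * ((n ∸ i) C j) ≡ 0
  rhs≡0 with ℕₚ.≤-<-connex i n
  ... | inj₂ n<i = ≡.cong (_* ((n ∸ i) C j)) (k>n⇒nCk≡0 n<i)
  ... | inj₁ i≤n = ≡.trans (≡.cong ((n C i) *_) (k>n⇒nCk≡0 n∸i<j)) (ℕₚ.*-zeroʳ (n C i))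
    where
    n∸i<j : n ∸ i < j
    n∸i<j = ℕₚ.+-cancelˡ-< i (n ∸ i) j (≡.subst (_< i + j) (≡.sym (ℕₚ.m+[n∸m]≡n i≤n)) n<i+j)
... | inj₁ i+j≤n = ℕₚ.*-cancelʳ-≡ _ _ (i ! * j ! * r !) {{denominator≢0}} (≡.trans lhs≡n! (≡.sym rhs≡n!))
  where
  open ≡.≡-Reasoning
  open ℕSolver using (_:*_; _:=_) renaming (solve to ℕ-solve)
  r = n ∸ (i + j)
  denominator≢0 : ℕ.NonZero (i ! * j ! * r !)
  denominator≢0 = ℕₚ.m*n≢0 (i ! * j !) (r !) {{i !* j !≢0}} {{r !≢0}}
  i≤n : i ≤ n
  i≤n = ℕₚ.≤-trans (ℕₚ.m≤m+n i j) i+j≤n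
  j≤n∸i : j ≤ n ∸ i
  j≤n∸i = ℕₚ.+-cancelˡ-≤ i j (n ∸ i) (≡.subst (i + j ≤_) (≡.sym (ℕₚ.m+[n∸m]≡n i≤n)) i+j≤n)
  lhs≡n! : (n C (i + j)) * ((i + j) C i) * (i ! * j ! * r !) ≡ n !
  lhs≡n! = begin
    (n C (i + j)) * ((i + j) C i) * (i ! * j ! * r !)
      ≡⟨ ℕ-solve 5 (λ a b x y z → a :* b :* (x :* y :* z) := a :* (b :* (x :* y)) :* z) ≡.refl
                   (n C (i + j)) ((i + j) C i) (i !) (j !) (r !) ⟩
    (n C (i + j)) * (((i + j) C i) * (i ! * j !)) * r !
      ≡⟨ ≡.cong (λ x → (n C (i + j)) * (((i + j) C i) * (i ! * x !)) * r !) (≡.sym (ℕₚ.m+n∸m≡n i j)) ⟩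
    (n C (i + j)) * (((i + j) C i) * (i ! * ((i + j) ∸ i) !)) * r !
      ≡⟨ ≡.cong (λ x → (n C (i + j)) * x * r !) (nCk*[k!*[n∸k]!]≡n! (i + j) i (ℕₚ.m≤m+n i j)) ⟩
    (n C (i + j)) * (i + j) ! * r !
      ≡⟨ ℕₚ.*-assoc (n C (i + j)) ((i + j) !) (r !) ⟩
    (n C (i + j)) * ((i + j) ! * r !)
      ≡⟨ nCk*[k!*[n∸k]!]≡n! n (i + j) i+j≤n ⟩
    n ! ∎
  rhs≡n! : (n C i) * ((n ∸ i) C j) * (i ! * j ! * r !) ≡ n !
  rhs≡n! = begin
    (n C i) * ((n ∸ i) C j) * (i ! * j ! * r !)
      ≡⟨ ℕ-solve 5 (λ a b x y z → a :* b :* (x :* y :* z) := a :* x :* (b :* (y :* z))) ≡.refl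
                   (n C i) ((n ∸ i) C j) (i !) (j !) (r !) ⟩
    (n C i) * i ! * (((n ∸ i) C j) * (j ! * r !))
      ≡⟨ ≡.cong (λ x → (n C i) * i ! * (((n ∸ i) C j) * (j ! * x !))) (≡.sym (ℕₚ.∸-+-assoc n i j)) ⟩
    (n C i) * i ! * (((n ∸ i) C j) * (j ! * ((n ∸ i) ∸ j) !))
      ≡⟨ ≡.cong ((n C i) * i ! *_) (nCk*[k!*[n∸k]!]≡n! (n ∸ i) j j≤n∸i) ⟩
    (n C i) * i ! * (n ∸ i) !
      ≡⟨ ℕₚ.*-assoc (n C i) (i !) ((n ∸ i) !) ⟩
    (n C i) * (i ! * (n ∸ i) !)
      ≡⟨ nCk*[k!*[n∸k]!]≡n! n i i≤n ⟩
    n ! ∎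

nCi*[n∸i]Cj≡nCj*[n∸j]Ci : ∀ n i j → (n C i) * ((n ∸ i) C j) ≡ (n C j) * ((n ∸ j) C i)
nCi*[n∸i]Cj≡nCj*[n∸j]Ci n i j = begin
  (n C i) * ((n ∸ i) C j)        ≡⟨ nC[i+j]*[i+j]Ci≡nCi*[n∸i]Cj n i j ⟨
  (n C (i + j)) * ((i + j) C i)  ≡⟨ ≡.cong₂ _*_ (≡.cong (n C_) (ℕₚ.+-comm i j)) [i+j]Ci≡[j+i]Cj ⟩
  (n C (j + i)) * ((j + i) C j)  ≡⟨ nC[i+j]*[i+j]Ci≡nCi*[n∸i]Cj n j i ⟩
  (n C j) * ((n ∸ j) C i)        ∎
  where
  open ≡.≡-Reasoning
  [i+j]Ci≡[j+i]Cj : (i + j) C i ≡ (j + i) C j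
  [i+j]Ci≡[j+i]Cj = begin
    (i + j) C i               ≡⟨ nCk≡nC[n∸k] (ℕₚ.m≤m+n i j) ⟩
    (i + j) C ((i + j) ∸ i)   ≡⟨ ≡.cong₂ _C_ (ℕₚ.+-comm i j) (ℕₚ.m+n∸m≡n i j) ⟩
    (j + i) C j               ∎

expAt : List ℕ → ℕ → ℕ
expAt []       _       = 0
expAt (x ∷ xs) zero    = x
expAt (x ∷ xs) (suc j) = expAt xs j

infix 4 _≗ᵉ_ _~_
_≗ᵉ_ : List ℕ → List ℕ → Set
xs ≗ᵉ ys = ∀ j → expAt xs j ≡ expAt ys j

record _~_ (m n : Mono) : Set where
  constructor _,~_
  field
    half2≡ : half2 m ≡ half2 n
    exps≗ : exps m ≗ᵉ exps n
open _~_

~-refl : ∀ {m} → m ~ m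
~-refl = ≡.refl ,~ λ _ → ≡.refl

~-sym : ∀ {m n} → m ~ n → n ~ m
~-sym (p ,~ q) = ≡.sym p ,~ λ j → ≡.sym (q j)

~-trans : ∀ {m n o} → m ~ n → n ~ o → m ~ o
~-trans (p ,~ q) (p′ ,~ q′) = ≡.trans p p′ ,~ λ j → ≡.trans (q j) (q′ j)

isZeros-sound : ∀ xs → T (isZeros xs) → ∀ j → expAt xs j ≡ 0
isZeros-sound []          _ j       = ≡.refl
isZeros-sound (zero ∷ xs) _ zero    = ≡.refl
isZeros-sound (zero ∷ xs) t (suc j) = isZeros-sound xs t j

isZeros-complete : ∀ xs → (∀ j → expAt xs j ≡ 0) → T (isZeros xs)
isZeros-complete []           _    = _
isZeros-complete (zero ∷ xs)  xs≡0 = isZeros-complete xs (xs≡0 ∘ suc)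
isZeros-complete (suc x ∷ xs) xs≡0 with () ← xs≡0 0

eqExps-sound : ∀ xs ys → T (eqExps xs ys) → xs ≗ᵉ ys
eqExps-sound []       ys       t j       = ≡.sym (isZeros-sound ys t j)
eqExps-sound (x ∷ xs) []       t j       = isZeros-sound (x ∷ xs) t j
eqExps-sound (x ∷ xs) (y ∷ ys) t zero    = ℕₚ.≡ᵇ⇒≡ x y (proj₁ (Equivalence.to T-∧ t))
eqExps-sound (x ∷ xs) (y ∷ ys) t (suc j) = eqExps-sound xs ys (proj₂ (Equivalence.to T-∧ t)) j

eqExps-complete : ∀ xs ys → xs ≗ᵉ ys → T (eqExps xs ys)
eqExps-complete []       ys       xs≗ys = isZeros-complete ys (λ j → ≡.sym (xs≗ys j))
eqExps-complete (x ∷ xs) []       xs≗ys = isZeros-complete (x ∷ xs) xs≗ys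
eqExps-complete (x ∷ xs) (y ∷ ys) xs≗ys =
  Equivalence.from T-∧ (ℕₚ.≡⇒≡ᵇ x y (xs≗ys 0) , eqExps-complete xs ys (xs≗ys ∘ suc))

eqℤ-sound : ∀ h k → T (eqℤ h k) → h ≡ k
eqℤ-sound (+ m)      (+ n)      t = ≡.cong +_ (ℕₚ.≡ᵇ⇒≡ m n t)
eqℤ-sound ℤ.-[1+ m ] ℤ.-[1+ n ] t = ≡.cong ℤ.-[1+_] (ℕₚ.≡ᵇ⇒≡ m n t)

eqℤ-refl : ∀ h → T (eqℤ h h)
eqℤ-refl (+ m)      = ℕₚ.≡⇒≡ᵇ m m ≡.refl
eqℤ-refl ℤ.-[1+ m ] = ℕₚ.≡⇒≡ᵇ m m ≡.refl

eqMono-reflects-~ : ∀ m n → Reflects (m ~ n) (eqMono m n)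
eqMono-reflects-~ (mono h xs) (mono k ys) = fromEquivalence sound complete
  where
  sound : T (eqMono (mono h xs) (mono k ys)) → mono h xs ~ mono k ys
  sound t = let th , txs = Equivalence.to T-∧ t in eqℤ-sound h k th ,~ eqExps-sound xs ys txs
  complete : mono h xs ~ mono k ys → T (eqMono (mono h xs) (mono k ys))
  complete (≡.refl ,~ xs≗ys) = Equivalence.from T-∧ (eqℤ-refl h , eqExps-complete xs ys xs≗ys)

incAt : ℕ → List ℕ → List ℕ
incAt zero    []       = 1 ∷ []
incAt zero    (x ∷ xs) = suc x ∷ xs
incAt (suc j) []       = 0 ∷ incAt j []
incAt (suc j) (x ∷ xs) = x ∷ incAt j xs

decAt : ℕ → List ℕ → List ℕ
decAt j xs = proj₂ (dList j xs)

record PointUpdate (t : ℕ → List ℕ → List ℕ) (φ : ℕ → ℕ) : Set where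
  field
    at-same  : ∀ a xs → expAt (t a xs) a ≡ φ (expAt xs a)
    at-other : ∀ a xs i → i ≢ a → expAt (t a xs) i ≡ expAt xs i
open PointUpdate

incAt-update : PointUpdate incAt suc
incAt-update = record { at-same = same ; at-other = other }
  where
  same : ∀ a xs → expAt (incAt a xs) a ≡ suc (expAt xs a)
  same zero    []       = ≡.refl
  same zero    (x ∷ xs) = ≡.refl
  same (suc a) []       = same a []
  same (suc a) (x ∷ xs) = same a xs
  other : ∀ a xs i → i ≢ a → expAt (incAt a xs) i ≡ expAt xs i
  other zero    []       zero    i≢a = contradiction ≡.refl i≢a
  other zero    []       (suc i) i≢a = ≡.refl
  other zero    (x ∷ xs) zero    i≢a = contradiction ≡.refl i≢a
  other zero    (x ∷ xs) (suc i) i≢a = ≡.refl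
  other (suc a) []       zero    i≢a = ≡.refl
  other (suc a) []       (suc i) i≢a = other a [] i (i≢a ∘ ≡.cong suc)
  other (suc a) (x ∷ xs) zero    i≢a = ≡.refl
  other (suc a) (x ∷ xs) (suc i) i≢a = other a xs i (i≢a ∘ ≡.cong suc)

decAt-update : PointUpdate decAt (_∸ 1)
decAt-update = record { at-same = same ; at-other = other }
  where
  same : ∀ a xs → expAt (decAt a xs) a ≡ expAt xs a ∸ 1
  same zero    []       = ≡.refl
  same (suc a) []       = ≡.refl
  same zero    (x ∷ xs) = ≡.refl
  same (suc a) (x ∷ xs) = same a xs
  other : ∀ a xs i → i ≢ a → expAt (decAt a xs) i ≡ expAt xs i
  other a       []       i       i≢a = ≡.refl
  other zero    (x ∷ xs) zero    i≢a = contradiction ≡.refl i≢a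
  other zero    (x ∷ xs) (suc i) i≢a = ≡.refl
  other (suc a) (x ∷ xs) zero    i≢a = ≡.refl
  other (suc a) (x ∷ xs) (suc i) i≢a = other a xs i (i≢a ∘ ≡.cong suc)

dList-coefficient : ∀ j xs → proj₁ (dList j xs) ≡ expAt xs j
dList-coefficient j       []       = ≡.refl
dList-coefficient zero    (x ∷ xs) = ≡.refl
dList-coefficient (suc j) (x ∷ xs) = dList-coefficient j xs

update-cong : ∀ {t φ} → PointUpdate t φ → ∀ a {xs ys} → xs ≗ᵉ ys → t a xs ≗ᵉ t a ys
update-cong {φ = φ} S a {xs} {ys} xs≗ys i with i ℕ.≟ a
... | yes ≡.refl = ≡.trans (at-same S i xs) (≡.trans (≡.cong φ (xs≗ys i)) (≡.sym (at-same S i ys)))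
... | no i≢a     = ≡.trans (at-other S a xs i i≢a) (≡.trans (xs≗ys i) (≡.sym (at-other S a ys i i≢a)))

module _ {s t φ ψ} (S : PointUpdate s φ) (U : PointUpdate t ψ) where

  open ≡.≡-Reasoning

  update-comm : ∀ {a b} → a ≢ b → ∀ xs → s a (t b xs) ≗ᵉ t b (s a xs)
  update-comm {a} {b} a≢b xs i with i ℕ.≟ a | i ℕ.≟ b
  ... | yes ≡.refl | yes ≡.refl = contradiction ≡.refl a≢b
  ... | yes ≡.refl | no i≢b = begin
    expAt (s i (t b xs)) i  ≡⟨ at-same S i (t b xs) ⟩
    φ (expAt (t b xs) i)    ≡⟨ ≡.cong φ (at-other U b xs i i≢b) ⟩
    φ (expAt xs i)          ≡⟨ at-same S i xs ⟨
    expAt (s i xs) i        ≡⟨ at-other U b (s i xs) i i≢b ⟨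
    expAt (t b (s i xs)) i  ∎
  ... | no i≢a | yes ≡.refl = begin
    expAt (s a (t i xs)) i  ≡⟨ at-other S a (t i xs) i i≢a ⟩
    expAt (t i xs) i        ≡⟨ at-same U i xs ⟩
    ψ (expAt xs i)          ≡⟨ ≡.cong ψ (at-other S a xs i i≢a) ⟨
    ψ (expAt (s a xs) i)    ≡⟨ at-same U i (s a xs) ⟨
    expAt (t i (s a xs)) i  ∎
  ... | no i≢a | no i≢b = begin
    expAt (s a (t b xs)) i  ≡⟨ at-other S a (t b xs) i i≢a ⟩
    expAt (t b xs) i        ≡⟨ at-other U b xs i i≢b ⟩
    expAt xs i              ≡⟨ at-other S a xs i i≢a ⟨
    expAt (s a xs) i        ≡⟨ at-other U b (s a xs) i i≢b ⟨
    expAt (t b (s a xs)) i  ∎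

  update-inverse : ∀ a xs → φ (ψ (expAt xs a)) ≡ expAt xs a → s a (t a xs) ≗ᵉ xs
  update-inverse a xs φψ≡id i with i ℕ.≟ a
  ... | yes ≡.refl = ≡.trans (at-same S i (t i xs)) (≡.trans (≡.cong φ (at-same U i xs)) φψ≡id)
  ... | no i≢a     = ≡.trans (at-other S a (t a xs) i i≢a) (at-other U a xs i i≢a)

-- Coefficient series and linear operators

record Series : Set where
  constructor series
  field
    _at_    : Mono → ℚ
    at-resp : ∀ {m n} → m ~ n → _at_ m ≡ _at_ n
open Series

infix 4 _≋_
record _≋_ (F G : Series) : Set where
  constructor pointwise
  field
    at≡ : ∀ m → F at m ≡ G at m
open _≋_

≋-refl : ∀ {F} → F ≋ F
≋-refl = pointwise λ _ → ≡.refl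

≋-sym : ∀ {F G} → F ≋ G → G ≋ F
≋-sym F≋G = pointwise λ m → ≡.sym (at≡ F≋G m)

≋-trans : ∀ {F G H} → F ≋ G → G ≋ H → F ≋ H
≋-trans F≋G G≋H = pointwise λ m → ≡.trans (at≡ F≋G m) (at≡ G≋H m)

0ˢ : Series
0ˢ = series (λ _ → 0ℚ) (λ _ → ≡.refl)

infixl 6 _+ˢ_
_+ˢ_ : Series → Series → Series
F +ˢ G = series (λ m → F at m ℚ.+ G at m) (λ m~n → ≡.cong₂ ℚ._+_ (at-resp F m~n) (at-resp G m~n))

infixr 7 _·ˢ_
_·ˢ_ : ℚ → Series → Series
c ·ˢ F = series (λ m → c ℚ.* F at m) (λ m~n → ≡.cong (c ℚ.*_) (at-resp F m~n))

+ˢ-0ˢ-commutativeMonoid : CommutativeMonoid 0ℓ 0ℓ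
+ˢ-0ˢ-commutativeMonoid = record
  { Carrier             = Series
  ; _≈_                 = _≋_
  ; _∙_                 = _+ˢ_
  ; ε                   = 0ˢ
  ; isCommutativeMonoid = record
    { isMonoid = record
      { isSemigroup = record
        { isMagma = record
          { isEquivalence = record { refl = ≋-refl ; sym = ≋-sym ; trans = ≋-trans }
          ; ∙-cong        = λ F≋F′ G≋G′ → pointwise λ m → ≡.cong₂ ℚ._+_ (at≡ F≋F′ m) (at≡ G≋G′ m)
          }
        ; assoc = λ F G H → pointwise λ m → ℚₚ.+-assoc (F at m) (G at m) (H at m)
        }
      ; identity = (λ F → pointwise λ m → ℚₚ.+-identityˡ (F at m)) , (λ F → pointwise λ m → ℚₚ.+-identityʳ (F at m))
      }
    ; comm = λ F G → pointwise λ m → ℚₚ.+-comm (F at m) (G at m)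
    }
  }

open FiniteSums +ˢ-0ˢ-commutativeMonoid public
module SeriesReasoning = Relation.Binary.Reasoning.Setoid (CommutativeMonoid.setoid +ˢ-0ˢ-commutativeMonoid)
open CommutativeMonoid +ˢ-0ˢ-commutativeMonoid public
  using () renaming (∙-cong to +ˢ-cong; assoc to +ˢ-assoc; comm to +ˢ-comm; identityˡ to +ˢ-identityˡ; identityʳ to +ˢ-identityʳ)

·ˢ-cong : ∀ c {F G} → F ≋ G → c ·ˢ F ≋ c ·ˢ G
·ˢ-cong c F≋G = pointwise λ m → ≡.cong (c ℚ.*_) (at≡ F≋G m)

·ˢ-assoc : ∀ c d F → c ·ˢ d ·ˢ F ≋ (c ℚ.* d) ·ˢ F
·ˢ-assoc c d F = pointwise λ m → ≡.sym (ℚₚ.*-assoc c d (F at m))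

·ˢ-distribʳ : ∀ c d F → (c ℚ.+ d) ·ˢ F ≋ c ·ˢ F +ˢ d ·ˢ F
·ˢ-distribʳ c d F = pointwise λ m → ℚₚ.*-distribʳ-+ (F at m) c d

⟦0⟧·ˢ : ∀ F → ⟦ 0 ⟧ ·ˢ F ≋ 0ˢ
⟦0⟧·ˢ F = pointwise λ m → ≡.trans (≡.cong (ℚ._* F at m) ⟦0⟧) (ℚₚ.*-zeroˡ (F at m))

⟦1⟧·ˢ : ∀ F → ⟦ 1 ⟧ ·ˢ F ≋ F
⟦1⟧·ˢ F = pointwise λ m → ≡.trans (≡.cong (ℚ._* F at m) ⟦1⟧) (ℚₚ.*-identityˡ (F at m))

record IsLinear (L : Series → Series) : Set where
  field
    cong   : ∀ {F G} → F ≋ G → L F ≋ L G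
    +-homo : ∀ F G → L (F +ˢ G) ≋ L F +ˢ L G
    ·-homo : ∀ c F → L (c ·ˢ F) ≋ c ·ˢ L F
    0-homo : L 0ˢ ≋ 0ˢ
open IsLinear

∑<-linear : ∀ {L} → IsLinear L → ∀ n f → L (∑< n f) ≋ ∑< n (L ∘ f)
∑<-linear L-lin = ∑<-homo (cong L-lin) (0-homo L-lin) (+-homo L-lin)

linear-vanishes : ∀ {L F} → IsLinear L → F ≋ 0ˢ → L F ≋ 0ˢ
linear-vanishes L-lin F≋0 = ≋-trans (cong L-lin F≋0) (0-homo L-lin)

∑<-·ˢ-linear : ∀ {L} → IsLinear L → ∀ n (c : ℕ → ℚ) (f : ℕ → Series) →
               L (∑< n (λ i → c i ·ˢ f i)) ≋ ∑< n (λ i → c i ·ˢ L (f i))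
∑<-·ˢ-linear L-lin n c f = ≋-trans (∑<-linear L-lin n (λ i → c i ·ˢ f i)) (∑<-cong n λ i → ·-homo L-lin (c i) (f i))

id-linear : IsLinear id
id-linear = record { cong = id ; +-homo = λ _ _ → ≋-refl ; ·-homo = λ _ _ → ≋-refl ; 0-homo = ≋-refl }

∘-linear : ∀ {L M} → IsLinear L → IsLinear M → IsLinear (L ∘ M)
∘-linear {L} {M} L-lin M-lin = record
  { cong   = cong L-lin ∘ cong M-lin
  ; +-homo = λ F G → ≋-trans (cong L-lin (+-homo M-lin F G)) (+-homo L-lin (M F) (M G))
  ; ·-homo = λ c F → ≋-trans (cong L-lin (·-homo M-lin c F)) (·-homo L-lin c (M F))
  ; 0-homo = linear-vanishes L-lin (0-homo M-lin)
  }

·ˢ-linear : ∀ c → IsLinear (c ·ˢ_)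
·ˢ-linear c = record
  { cong   = ·ˢ-cong c
  ; +-homo = λ F G → pointwise λ m → ℚₚ.*-distribˡ-+ c (F at m) (G at m)
  ; ·-homo = λ d F → pointwise λ m → ℚ*.x∙yz≈y∙xz c d (F at m)
  ; 0-homo = pointwise λ _ → ℚₚ.*-zeroʳ c
  }

0-linear : IsLinear (λ _ → 0ˢ)
0-linear = record
  { cong   = λ _ → ≋-refl
  ; +-homo = λ _ _ → ≋-sym (+ˢ-identityˡ 0ˢ)
  ; ·-homo = λ c _ → pointwise λ _ → ≡.sym (ℚₚ.*-zeroʳ c)
  ; 0-homo = ≋-refl
  }

∑<-pointwise-linear : ∀ n {L : ℕ → Series → Series} → (∀ i → IsLinear (L i)) → IsLinear (λ F → ∑< n (λ i → L i F))
∑<-pointwise-linear n {L} L-lin = record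
  { cong   = λ F≋G → ∑<-cong n (λ i → cong (L-lin i) F≋G)
  ; +-homo = λ F G → ≋-trans (∑<-cong n (λ i → +-homo (L-lin i) F G)) (∑<-distrib n (λ i → L i F) (λ i → L i G))
  ; ·-homo = λ c F → ≋-trans (∑<-cong n (λ i → ·-homo (L-lin i) c F)) (≋-sym (∑<-linear (·ˢ-linear c) n (λ i → L i F)))
  ; 0-homo = ∑<-zero n (λ i _ → 0-homo (L-lin i))
  }

∑<-·ˢ-distrib : ∀ n (c : ℕ → ℚ) (f g : ℕ → Series) →
                ∑< n (λ i → c i ·ˢ (f i +ˢ g i)) ≋ ∑< n (λ i → c i ·ˢ f i) +ˢ ∑< n (λ i → c i ·ˢ g i)
∑<-·ˢ-distrib n c f g =
  ≋-trans (∑<-cong n λ i → +-homo (·ˢ-linear (c i)) (f i) (g i)) (∑<-distrib n (λ i → c i ·ˢ f i) (λ i → c i ·ˢ g i))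

≡⇒≋ : ∀ {F G} → F ≡ G → F ≋ G
≡⇒≋ ≡.refl = ≋-refl

∸-comm : ∀ k a b → k ∸ a ∸ b ≡ k ∸ b ∸ a
∸-comm k a b = ≡.trans (ℕₚ.∸-+-assoc k a b) (≡.trans (≡.cong (k ∸_) (ℕₚ.+-comm a b)) (≡.sym (ℕₚ.∸-+-assoc k b a)))

⟦⟧·ˢ-cong : ∀ {a b F G} → a ≡ b → F ≋ G → ⟦ a ⟧ ·ˢ F ≋ ⟦ b ⟧ ·ˢ G
⟦⟧·ˢ-cong {a} ≡.refl F≋G = ·ˢ-cong ⟦ a ⟧ F≋G

⟦⟧·ˢ-assoc : ∀ a b F → ⟦ a ⟧ ·ˢ ⟦ b ⟧ ·ˢ F ≋ ⟦ a * b ⟧ ·ˢ F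
⟦⟧·ˢ-assoc a b F = ≋-trans (·ˢ-assoc ⟦ a ⟧ ⟦ b ⟧ F) (pointwise λ m → ≡.cong (ℚ._* F at m) (≡.sym (⟦⟧-* a b)))

⟦⟧·ˢ-distrib : ∀ a b F → ⟦ a + b ⟧ ·ˢ F ≋ ⟦ a ⟧ ·ˢ F +ˢ ⟦ b ⟧ ·ˢ F
⟦⟧·ˢ-distrib a b F = ≋-trans (pointwise λ m → ≡.cong (ℚ._* F at m) (⟦⟧-+ a b)) (·ˢ-distribʳ ⟦ a ⟧ ⟦ b ⟧ F)

⟦⟧·ˢ-pull : ∀ {L} → IsLinear L → ∀ a b F → ⟦ a ⟧ ·ˢ L (⟦ b ⟧ ·ˢ F) ≋ ⟦ a * b ⟧ ·ˢ L F
⟦⟧·ˢ-pull {L} L-lin a b F = ≋-trans (·ˢ-cong ⟦ a ⟧ (·-homo L-lin ⟦ b ⟧ F)) (⟦⟧·ˢ-assoc a b (L F))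

⟦⟧·ˢ-∑<-pull : ∀ {L} → IsLinear L → ∀ a n (b : ℕ → ℕ) (X : ℕ → Series) →
               ⟦ a ⟧ ·ˢ L (∑< n (λ j → ⟦ b j ⟧ ·ˢ X j)) ≋ ∑< n (λ j → ⟦ a * b j ⟧ ·ˢ L (X j))
⟦⟧·ˢ-∑<-pull {L} L-lin a n b X = ≋-trans (·ˢ-cong ⟦ a ⟧ (∑<-linear L-lin n (λ j → ⟦ b j ⟧ ·ˢ X j)))
  (≋-trans (∑<-linear (·ˢ-linear ⟦ a ⟧) n (λ j → L (⟦ b j ⟧ ·ˢ X j))) (∑<-cong n λ j → ⟦⟧·ˢ-pull L-lin a (b j) (X j)))

⟦⟧·ˢ-zero : ∀ {a} F → a ≡ 0 → ⟦ a ⟧ ·ˢ F ≋ 0ˢ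
⟦⟧·ˢ-zero F ≡.refl = ⟦0⟧·ˢ F

⟦nCk⟧·ˢ-vanishes : ∀ {n k} F → n < k → ⟦ n C k ⟧ ·ˢ F ≋ 0ˢ
⟦nCk⟧·ˢ-vanishes F n<k = ⟦⟧·ˢ-zero F (k>n⇒nCk≡0 n<k)

∑<-binomial-comm : ∀ n (g : ℕ → ℕ → Series) →
                   ∑< (suc n) (λ i → ∑< (suc (n ∸ i)) (λ j → ⟦ (n C i) * ((n ∸ i) C j) ⟧ ·ˢ g i j))
                   ≋ ∑< (suc n) (λ j → ∑< (suc (n ∸ j)) (λ i → ⟦ (n C j) * ((n ∸ j) C i) ⟧ ·ˢ g i j))
∑<-binomial-comm n g =
  ≋-trans (∑<-comm-simplex n _ (λ i j n∸i<j → ⟦⟧·ˢ-zero (g i j) (first≡0 i j n∸i<j))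
                               (λ i j n∸j<i → ⟦⟧·ˢ-zero (g i j) (second≡0 i j n∸j<i)))
  (∑<-cong (suc n) λ j → ∑<-cong (suc (n ∸ j)) λ i → ⟦⟧·ˢ-cong (nCi*[n∸i]Cj≡nCj*[n∸j]Ci n i j) ≋-refl)
  where
  first≡0 : ∀ i j → n ∸ i < j → (n C i) * ((n ∸ i) C j) ≡ 0
  first≡0 i j n∸i<j = ≡.trans (≡.cong ((n C i) *_) (k>n⇒nCk≡0 n∸i<j)) (ℕₚ.*-zeroʳ (n C i))
  second≡0 : ∀ i j → n ∸ j < i → (n C i) * ((n ∸ i) C j) ≡ 0
  second≡0 i j n∸j<i = ≡.trans (nCi*[n∸i]Cj≡nCj*[n∸j]Ci n i j) (first≡0 j i n∸j<i)

-- Partial derivatives and multiplication by a variable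

data Var : Set where
  q₂   : Var
  slot : ℕ → Var

-- `var i` is Q_{i+1}: exponent-list slot 0 holds Q₁ and slot j ≥ 1 holds Q_{j+2}.
var : ℕ → Var
var zero          = slot 0
var (suc zero)    = q₂
var (suc (suc j)) = slot (suc j)

var-injective : ∀ {i j} → var i ≡ var j → i ≡ j
var-injective {zero}        {zero}        _      = ≡.refl
var-injective {suc zero}    {suc zero}    _      = ≡.refl
var-injective {suc (suc i)} {suc (suc j)} ≡.refl = ≡.refl
var-injective {zero}        {suc zero}    ()
var-injective {zero}        {suc (suc j)} ()
var-injective {suc zero}    {zero}        ()
var-injective {suc zero}    {suc (suc j)} ()
var-injective {suc (suc i)} {zero}        ()
var-injective {suc (suc i)} {suc zero}    ()

mulSlot divSlot : ℕ → Mono → Mono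
mulSlot a m = mono (half2 m) (incAt a (exps m))
divSlot a m = mono (half2 m) (decAt a (exps m))

mulQ₂ divQ₂ : Mono → Mono
mulQ₂ m = mono (half2 m ℤ.+ + 2) (exps m)
divQ₂ m = mono (half2 m ℤ.- + 2) (exps m)

whenPositive : ℕ → ℚ → ℚ
whenPositive zero    _ = 0ℚ
whenPositive (suc _) x = x

mulVar : Var → Mono → Mono
mulVar q₂       = mulQ₂
mulVar (slot a) = mulSlot a

mulVar-resp : ∀ v {m n} → m ~ n → mulVar v m ~ mulVar v n
mulVar-resp q₂       m~n = ≡.cong (ℤ._+ + 2) (half2≡ m~n) ,~ exps≗ m~n
mulVar-resp (slot a) {m} {n} m~n = half2≡ m~n ,~ update-cong incAt-update a {exps m} {exps n} (exps≗ m~n)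

expMulVar : Var → Mono → ℚ
expMulVar q₂       m = (half2 m ℤ.+ + 2) ℚ./ 2
expMulVar (slot a) m = ⟦ suc (expAt (exps m) a) ⟧

expMulVar-resp : ∀ v {m n} → m ~ n → expMulVar v m ≡ expMulVar v n
expMulVar-resp q₂       m~n = ≡.cong (λ h → (h ℤ.+ + 2) ℚ./ 2) (half2≡ m~n)
expMulVar-resp (slot a) m~n = ≡.cong (λ e → ⟦ suc e ⟧) (exps≗ m~n a)

-- The coefficient of m in ∂F/∂v comes from the term m·v of F, the one in v·F from the term m/v (absent unless v divides m).
∂ᵛ : Var → Series → Series
∂ᵛ v F = series (λ m → expMulVar v m ℚ.* F at mulVar v m)
  λ m~n → ≡.cong₂ ℚ._*_ (expMulVar-resp v m~n) (at-resp F (mulVar-resp v m~n))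

Xᵛ : Var → Series → Series
Xᵛ q₂ F = series (λ m → F at divQ₂ m) λ m~n → at-resp F (≡.cong (ℤ._- + 2) (half2≡ m~n) ,~ exps≗ m~n)
Xᵛ (slot a) F = series (λ m → whenPositive (expAt (exps m) a) (F at divSlot a m))
  λ {m} {n} m~n → ≡.cong₂ whenPositive (exps≗ m~n a) (at-resp F (half2≡ m~n ,~ update-cong decAt-update a {exps m} {exps n} (exps≗ m~n)))

∂ᵛ-linear : ∀ v → IsLinear (∂ᵛ v)
∂ᵛ-linear v = record
  { cong   = λ F≋G → pointwise λ m → ≡.cong (expMulVar v m ℚ.*_) (at≡ F≋G (mulVar v m))
  ; +-homo = λ F G → pointwise λ m → ℚₚ.*-distribˡ-+ (expMulVar v m) (F at mulVar v m) (G at mulVar v m)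
  ; ·-homo = λ c F → pointwise λ m → ℚ*.x∙yz≈y∙xz (expMulVar v m) c (F at mulVar v m)
  ; 0-homo = pointwise λ m → ℚₚ.*-zeroʳ (expMulVar v m)
  }

whenPositive-+ : ∀ e x y → whenPositive e (x ℚ.+ y) ≡ whenPositive e x ℚ.+ whenPositive e y
whenPositive-+ zero    x y = ≡.sym (ℚₚ.+-identityˡ 0ℚ)
whenPositive-+ (suc e) x y = ≡.refl

whenPositive-* : ∀ e c x → whenPositive e (c ℚ.* x) ≡ c ℚ.* whenPositive e x
whenPositive-* zero    c x = ≡.sym (ℚₚ.*-zeroʳ c)
whenPositive-* (suc e) c x = ≡.refl

whenPositive-0 : ∀ e → whenPositive e 0ℚ ≡ 0ℚ
whenPositive-0 zero    = ≡.refl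
whenPositive-0 (suc e) = ≡.refl

Xᵛ-linear : ∀ v → IsLinear (Xᵛ v)
Xᵛ-linear q₂ = record
  { cong   = λ F≋G → pointwise λ m → at≡ F≋G (divQ₂ m)
  ; +-homo = λ _ _ → ≋-refl
  ; ·-homo = λ _ _ → ≋-refl
  ; 0-homo = ≋-refl
  }
Xᵛ-linear (slot a) = record
  { cong   = λ F≋G → pointwise λ m → ≡.cong (whenPositive (expAt (exps m) a)) (at≡ F≋G (divSlot a m))
  ; +-homo = λ F G → pointwise λ m → whenPositive-+ (expAt (exps m) a) (F at divSlot a m) (G at divSlot a m)
  ; ·-homo = λ c F → pointwise λ m → whenPositive-* (expAt (exps m) a) c (F at divSlot a m)
  ; 0-homo = pointwise λ m → whenPositive-0 (expAt (exps m) a)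
  }

whenPositive-swap : ∀ d e x → whenPositive d (whenPositive e x) ≡ whenPositive e (whenPositive d x)
whenPositive-swap zero    zero    x = ≡.refl
whenPositive-swap zero    (suc e) x = ≡.refl
whenPositive-swap (suc d) zero    x = ≡.refl
whenPositive-swap (suc d) (suc e) x = ≡.refl

∂ᵛ-comm : ∀ u v F → ∂ᵛ u (∂ᵛ v F) ≋ ∂ᵛ v (∂ᵛ u F)
∂ᵛ-comm q₂       q₂       F = ≋-refl
∂ᵛ-comm q₂       (slot b) F = pointwise λ m → ℚ*.x∙yz≈y∙xz (expMulVar q₂ m) (expMulVar (slot b) m) _
∂ᵛ-comm (slot a) q₂       F = pointwise λ m → ℚ*.x∙yz≈y∙xz (expMulVar (slot a) m) (expMulVar q₂ m) _
∂ᵛ-comm (slot a) (slot b) F with a ℕ.≟ b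
... | yes ≡.refl = pointwise λ _ → ≡.refl
... | no a≢b     = pointwise λ m → begin
  ⟦ suc (expAt (exps m) a) ⟧ ℚ.* (⟦ suc (expAt (incAt a (exps m)) b) ⟧ ℚ.* F at mono (half2 m) (incAt b (incAt a (exps m))))
    ≡⟨ ≡.cong₂ (λ e x → ⟦ suc (expAt (exps m) a) ⟧ ℚ.* (⟦ suc e ⟧ ℚ.* x))
               (at-other incAt-update a (exps m) b (a≢b ∘ ≡.sym))
               (at-resp F (≡.refl ,~ update-comm incAt-update incAt-update (a≢b ∘ ≡.sym) (exps m))) ⟩
  ⟦ suc (expAt (exps m) a) ⟧ ℚ.* (⟦ suc (expAt (exps m) b) ⟧ ℚ.* F at mono (half2 m) (incAt a (incAt b (exps m))))
    ≡⟨ ℚ*.x∙yz≈y∙xz ⟦ suc (expAt (exps m) a) ⟧ ⟦ suc (expAt (exps m) b) ⟧ _ ⟩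
  ⟦ suc (expAt (exps m) b) ⟧ ℚ.* (⟦ suc (expAt (exps m) a) ⟧ ℚ.* F at mono (half2 m) (incAt a (incAt b (exps m))))
    ≡⟨ ≡.cong (λ e → ⟦ suc (expAt (exps m) b) ⟧ ℚ.* (⟦ suc e ⟧ ℚ.* F at mono (half2 m) (incAt a (incAt b (exps m)))))
              (at-other incAt-update b (exps m) a a≢b) ⟨
  ⟦ suc (expAt (exps m) b) ⟧ ℚ.* (⟦ suc (expAt (incAt b (exps m)) a) ⟧ ℚ.* F at mono (half2 m) (incAt a (incAt b (exps m)))) ∎
  where open ≡.≡-Reasoning

Xᵛ-comm : ∀ u v F → Xᵛ u (Xᵛ v F) ≋ Xᵛ v (Xᵛ u F)
Xᵛ-comm q₂       q₂       F = ≋-refl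
Xᵛ-comm q₂       (slot b) F = ≋-refl
Xᵛ-comm (slot a) q₂       F = ≋-refl
Xᵛ-comm (slot a) (slot b) F with a ℕ.≟ b
... | yes ≡.refl = pointwise λ _ → ≡.refl
... | no a≢b     = pointwise λ m → begin
  whenPositive (expAt (exps m) a) (whenPositive (expAt (decAt a (exps m)) b) (F at mono (half2 m) (decAt b (decAt a (exps m)))))
    ≡⟨ ≡.cong₂ (λ e x → whenPositive (expAt (exps m) a) (whenPositive e x))
               (at-other decAt-update a (exps m) b (a≢b ∘ ≡.sym))
               (at-resp F (≡.refl ,~ update-comm decAt-update decAt-update (a≢b ∘ ≡.sym) (exps m))) ⟩
  whenPositive (expAt (exps m) a) (whenPositive (expAt (exps m) b) (F at mono (half2 m) (decAt a (decAt b (exps m)))))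
    ≡⟨ whenPositive-swap (expAt (exps m) a) (expAt (exps m) b) _ ⟩
  whenPositive (expAt (exps m) b) (whenPositive (expAt (exps m) a) (F at mono (half2 m) (decAt a (decAt b (exps m)))))
    ≡⟨ ≡.cong (λ e → whenPositive (expAt (exps m) b) (whenPositive e (F at mono (half2 m) (decAt a (decAt b (exps m))))))
              (at-other decAt-update b (exps m) a a≢b) ⟨
  whenPositive (expAt (exps m) b) (whenPositive (expAt (decAt b (exps m)) a) (F at mono (half2 m) (decAt a (decAt b (exps m))))) ∎
  where open ≡.≡-Reasoning

∂ᵛ-Xᵛ-other : ∀ {u v} → u ≢ v → ∀ F → ∂ᵛ u (Xᵛ v F) ≋ Xᵛ v (∂ᵛ u F)
∂ᵛ-Xᵛ-other {q₂}     {q₂}     u≢v F = contradiction ≡.refl u≢v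
∂ᵛ-Xᵛ-other {q₂}     {slot b} u≢v F = pointwise λ m → ≡.sym (whenPositive-* (expAt (exps m) b) (expMulVar q₂ m) _)
∂ᵛ-Xᵛ-other {slot a} {q₂}     u≢v F = ≋-refl
∂ᵛ-Xᵛ-other {slot a} {slot b} u≢v F = pointwise λ m → begin
  ⟦ suc (expAt (exps m) a) ⟧ ℚ.* whenPositive (expAt (incAt a (exps m)) b) (F at mono (half2 m) (decAt b (incAt a (exps m))))
    ≡⟨ ≡.cong₂ (λ e x → ⟦ suc (expAt (exps m) a) ⟧ ℚ.* whenPositive e x)
               (at-other incAt-update a (exps m) b (a≢b ∘ ≡.sym))
               (at-resp F (≡.refl ,~ update-comm decAt-update incAt-update (a≢b ∘ ≡.sym) (exps m))) ⟩
  ⟦ suc (expAt (exps m) a) ⟧ ℚ.* whenPositive (expAt (exps m) b) (F at mono (half2 m) (incAt a (decAt b (exps m))))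
    ≡⟨ whenPositive-* (expAt (exps m) b) ⟦ suc (expAt (exps m) a) ⟧ _ ⟨
  whenPositive (expAt (exps m) b) (⟦ suc (expAt (exps m) a) ⟧ ℚ.* F at mono (half2 m) (incAt a (decAt b (exps m))))
    ≡⟨ ≡.cong (λ e → whenPositive (expAt (exps m) b) (⟦ suc e ⟧ ℚ.* F at mono (half2 m) (incAt a (decAt b (exps m)))))
              (at-other decAt-update b (exps m) a a≢b) ⟨
  whenPositive (expAt (exps m) b) (⟦ suc (expAt (decAt b (exps m)) a) ⟧ ℚ.* F at mono (half2 m) (incAt a (decAt b (exps m)))) ∎
  where
  open ≡.≡-Reasoning
  a≢b : a ≢ b
  a≢b = u≢v ∘ ≡.cong slot

∂ᵛ-Xᵛ-same : ∀ v F → ∂ᵛ v (Xᵛ v F) ≋ Xᵛ v (∂ᵛ v F) +ˢ F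
∂ᵛ-Xᵛ-same q₂ F = pointwise λ m → begin
  ((half2 m ℤ.+ + 2) ℚ./ 2) ℚ.* F at divQ₂ (mulQ₂ m)
    ≡⟨ ≡.cong₂ ℚ._*_ ([h+2]/2≡h/2+1 (half2 m)) (at-resp F (h+2-2≡h (half2 m) ,~ λ _ → ≡.refl)) ⟩
  ((half2 m ℚ./ 2) ℚ.+ 1ℚ) ℚ.* F at m
    ≡⟨ [x+1]*y≡x*y+y (half2 m ℚ./ 2) (F at m) ⟩
  (half2 m ℚ./ 2) ℚ.* F at m ℚ.+ F at m
    ≡⟨ ≡.cong (λ h → (h ℚ./ 2) ℚ.* F at mono h (exps m) ℚ.+ F at m) (h-2+2≡h (half2 m)) ⟨
  (((half2 m ℤ.- + 2) ℤ.+ + 2) ℚ./ 2) ℚ.* F at mulQ₂ (divQ₂ m) ℚ.+ F at m ∎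
  where
  open ≡.≡-Reasoning
∂ᵛ-Xᵛ-same (slot a) F = pointwise λ m → begin
  ⟦ suc (expAt (exps m) a) ⟧ ℚ.* whenPositive (expAt (incAt a (exps m)) a) (F at divSlot a (mulSlot a m))
    ≡⟨ ≡.cong₂ (λ e x → ⟦ suc (expAt (exps m) a) ⟧ ℚ.* whenPositive e x) (at-same incAt-update a (exps m))
               (at-resp F (≡.refl ,~ update-inverse decAt-update incAt-update a (exps m) ≡.refl)) ⟩
  ⟦ suc (expAt (exps m) a) ⟧ ℚ.* F at m
    ≡⟨ split m (expAt (exps m) a) ≡.refl ⟩
  whenPositive (expAt (exps m) a) (⟦ suc (expAt (decAt a (exps m)) a) ⟧ ℚ.* F at mulSlot a (divSlot a m)) ℚ.+ F at m ∎
  where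
  open ≡.≡-Reasoning
  split : ∀ m e → expAt (exps m) a ≡ e →
          ⟦ suc e ⟧ ℚ.* F at m ≡ whenPositive e (⟦ suc (expAt (decAt a (exps m)) a) ⟧ ℚ.* F at mulSlot a (divSlot a m)) ℚ.+ F at m
  split m zero    _  = ≡.trans (≡.cong (ℚ._* F at m) ⟦1⟧)
                               (≡.trans (ℚₚ.*-identityˡ (F at m)) (≡.sym (ℚₚ.+-identityˡ (F at m))))
  split m (suc e) e≡ = begin
    ⟦ suc (suc e) ⟧ ℚ.* F at m
      ≡⟨ ≡.trans (≡.cong (ℚ._* F at m) (⟦suc⟧ (suc e))) ([x+1]*y≡x*y+y ⟦ suc e ⟧ (F at m)) ⟩
    ⟦ suc e ⟧ ℚ.* F at m ℚ.+ F at m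
      ≡⟨ ≡.cong₂ (λ d x → ⟦ suc d ⟧ ℚ.* x ℚ.+ F at m)
                 (≡.sym (≡.trans (at-same decAt-update a (exps m)) (≡.cong (_∸ 1) e≡)))
                 (at-resp F (≡.refl ,~ λ i → ≡.sym (update-inverse incAt-update decAt-update a (exps m) 1+[e∸1]≡e i))) ⟩
    ⟦ suc (expAt (decAt a (exps m)) a) ⟧ ℚ.* F at mulSlot a (divSlot a m) ℚ.+ F at m ∎
    where
    1+[e∸1]≡e : suc (expAt (exps m) a ∸ 1) ≡ expAt (exps m) a
    1+[e∸1]≡e rewrite e≡ = ≡.refl

∂ˢ : ℕ → Series → Series
∂ˢ zero    _ = 0ˢ
∂ˢ (suc i)   = ∂ᵛ (var i)

Qˢ : ℕ → Series → Series
Qˢ zero      = id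
Qˢ (suc l)   = Xᵛ (var l)

∂ˢ-linear : ∀ k → IsLinear (∂ˢ k)
∂ˢ-linear zero    = 0-linear
∂ˢ-linear (suc i) = ∂ᵛ-linear (var i)

Qˢ-linear : ∀ k → IsLinear (Qˢ k)
Qˢ-linear zero    = id-linear
Qˢ-linear (suc l) = Xᵛ-linear (var l)

∂ˢ-comm : ∀ j k F → ∂ˢ j (∂ˢ k F) ≋ ∂ˢ k (∂ˢ j F)
∂ˢ-comm zero    zero    F = ≋-refl
∂ˢ-comm zero    (suc k) F = ≋-sym (0-homo (∂ˢ-linear (suc k)))
∂ˢ-comm (suc j) zero    F = 0-homo (∂ˢ-linear (suc j))
∂ˢ-comm (suc j) (suc k) F = ∂ᵛ-comm (var j) (var k) F

Qˢ-comm : ∀ k l F → Qˢ k (Qˢ l F) ≋ Qˢ l (Qˢ k F)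
Qˢ-comm zero    zero    F = ≋-refl
Qˢ-comm zero    (suc l) F = ≋-refl
Qˢ-comm (suc k) zero    F = ≋-refl
Qˢ-comm (suc k) (suc l) F = Xᵛ-comm (var k) (var l) F

δˢ : ℕ → ℕ → Series → Series
δˢ i l F with i ℕ.≟ l
... | yes _ = F
... | no  _ = 0ˢ

δˢ-same : ∀ i F → δˢ i i F ≋ F
δˢ-same i F with i ℕ.≟ i
... | yes _  = ≋-refl
... | no i≢i = contradiction ≡.refl i≢i

δˢ-other : ∀ {i l} → i ≢ l → ∀ F → δˢ i l F ≋ 0ˢ
δˢ-other {i} {l} i≢l F with i ℕ.≟ l
... | yes i≡l = contradiction i≡l i≢l
... | no  _   = ≋-refl

∂ˢ-Qˢ : ∀ i l F → ∂ˢ (suc i) (Qˢ (suc l) F) ≋ Qˢ (suc l) (∂ˢ (suc i) F) +ˢ δˢ i l F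
∂ˢ-Qˢ i l F with i ℕ.≟ l
... | yes ≡.refl = ∂ᵛ-Xᵛ-same (var i) F
... | no i≢l     = ≋-trans (∂ᵛ-Xᵛ-other (i≢l ∘ var-injective) F) (≋-sym (+ˢ-identityʳ _))

termˢ : ℚ → Mono → Series
termˢ c n = series (λ m → if eqMono m n then c else 0ℚ) resp
  where
  resp : ∀ {m m′} → m ~ m′ → (if eqMono m n then c else 0ℚ) ≡ (if eqMono m′ n then c else 0ℚ)
  resp {m} {m′} m~m′ with eqMono m n | eqMono-reflects-~ m n | eqMono m′ n | eqMono-reflects-~ m′ n
  ... | true  | _       | true  | _        = ≡.refl
  ... | false | _       | false | _        = ≡.refl
  ... | true  | ofʸ m~n | false | ofⁿ m′≁n = contradiction (~-trans (~-sym m~m′) m~n) m′≁n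
  ... | false | ofⁿ m≁n | true  | ofʸ m′~n = contradiction (~-trans m~m′ m′~n) m≁n

termˢ-at-~ : ∀ c {n m} → m ~ n → termˢ c n at m ≡ c
termˢ-at-~ c {n} {m} m~n with eqMono m n | eqMono-reflects-~ m n
... | true  | _       = ≡.refl
... | false | ofⁿ m≁n = contradiction m~n m≁n

termˢ-at-≁ : ∀ c {n m} → ¬ m ~ n → termˢ c n at m ≡ 0ℚ
termˢ-at-≁ c {n} {m} m≁n with eqMono m n | eqMono-reflects-~ m n
... | true  | ofʸ m~n = contradiction m~n m≁n
... | false | _       = ≡.refl

termˢ-at-⇔ : ∀ c {n m n′ m′} → (m ~ n → m′ ~ n′) → (m′ ~ n′ → m ~ n) → termˢ c n at m ≡ termˢ c n′ at m′
termˢ-at-⇔ c {n} {m} to from with eqMono m n | eqMono-reflects-~ m n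
... | true  | ofʸ m~n = ≡.sym (termˢ-at-~ c (to m~n))
... | false | ofⁿ m≁n = ≡.sym (termˢ-at-≁ c (m≁n ∘ from))

termˢ-cong : ∀ {c d n n′} → c ≡ d → n ~ n′ → termˢ c n ≋ termˢ d n′
termˢ-cong {c} ≡.refl n~n′ = pointwise λ m →
  termˢ-at-⇔ c {m = m} (λ m~n → ~-trans m~n n~n′) (λ m~n′ → ~-trans m~n′ (~-sym n~n′))

mulSlot-~⇒~-divSlot : ∀ a m n → mulSlot a m ~ n → m ~ divSlot a n
mulSlot-~⇒~-divSlot a m n (h≡ ,~ xs≗) = h≡ ,~ λ j → begin
  expAt (exps m) j                              ≡⟨ update-inverse decAt-update incAt-update a (exps m) ≡.refl j ⟨
  expAt (decAt a (incAt a (exps m))) j          ≡⟨ update-cong decAt-update a {incAt a (exps m)} {exps n} xs≗ j ⟩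
  expAt (decAt a (exps n)) j                    ∎
  where open ≡.≡-Reasoning

~-divSlot⇒mulSlot-~ : ∀ a m n → 0 < expAt (exps n) a → m ~ divSlot a n → mulSlot a m ~ n
~-divSlot⇒mulSlot-~ a m n 0<e (h≡ ,~ xs≗) = h≡ ,~ λ j → begin
  expAt (incAt a (exps m)) j                    ≡⟨ update-cong incAt-update a {exps m} {decAt a (exps n)} xs≗ j ⟩
  expAt (incAt a (decAt a (exps n))) j          ≡⟨ update-inverse incAt-update decAt-update a (exps n) (ℕₚ.m+[n∸m]≡n 0<e) j ⟩
  expAt (exps n) j                              ∎
  where open ≡.≡-Reasoning

mulQ₂-~⇔~-divQ₂ : ∀ m n → (mulQ₂ m ~ n → m ~ divQ₂ n) × (m ~ divQ₂ n → mulQ₂ m ~ n)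
mulQ₂-~⇔~-divQ₂ m n =
  (λ (h≡ ,~ xs≗) → ≡.trans (≡.sym (h+2-2≡h (half2 m))) (≡.cong (ℤ._- + 2) h≡) ,~ xs≗) ,
  (λ (h≡ ,~ xs≗) → ≡.trans (≡.cong (ℤ._+ + 2) h≡) (h-2+2≡h (half2 n)) ,~ xs≗)

termˢ-at-0 : ∀ {c} n m → c ≡ 0ℚ → termˢ c n at m ≡ 0ℚ
termˢ-at-0 n m c≡0 with eqMono m n
... | true  = c≡0
... | false = ≡.refl

divVar : Var → Mono → Mono
divVar q₂       = divQ₂
divVar (slot a) = divSlot a

expVar : Var → Mono → ℚ
expVar q₂       n = half2 n ℚ./ 2
expVar (slot a) n = ⟦ expAt (exps n) a ⟧

termˢ-mulVar : ∀ v d n → termˢ d (mulVar v n) ≋ Xᵛ v (termˢ d n)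
termˢ-mulVar q₂ d n = pointwise λ m →
  termˢ-at-⇔ d {m = m} (λ m~n·q₂ → ~-sym (proj₁ (mulQ₂-~⇔~-divQ₂ n m) (~-sym m~n·q₂)))
                     (λ m/q₂~n → ~-sym (proj₂ (mulQ₂-~⇔~-divQ₂ n m) (~-sym m/q₂~n)))
termˢ-mulVar (slot a) d n = pointwise λ m → coefficient m (expAt (exps m) a) ≡.refl
  where
  coefficient : ∀ m e → expAt (exps m) a ≡ e → termˢ d (mulSlot a n) at m ≡ whenPositive e (termˢ d n at divSlot a m)
  coefficient m zero    e≡0 = termˢ-at-≁ d {mulSlot a n} {m} λ m~n·a →
    0≢1+n (≡.trans (≡.sym e≡0) (≡.trans (exps≗ m~n·a a) (at-same incAt-update a (exps n))))
  coefficient m (suc e) e≡  = termˢ-at-⇔ d {m = m} (λ m~n·a → ~-sym (mulSlot-~⇒~-divSlot a n m (~-sym m~n·a)))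
                     (λ m/a~n → ~-sym (~-divSlot⇒mulSlot-~ a n m (≡.subst (0 <_) (≡.sym e≡) (s≤s z≤n)) (~-sym m/a~n)))

termˢ-divVar : ∀ v c n → termˢ (c ℚ.* expVar v n) (divVar v n) ≋ ∂ᵛ v (termˢ c n)
termˢ-divVar v c n = pointwise λ m → coefficient v m
  where
  coefficient : ∀ v m → termˢ (c ℚ.* expVar v n) (divVar v n) at m ≡ expMulVar v m ℚ.* termˢ c n at mulVar v m
  coefficient v m with eqMono (mulVar v m) n | eqMono-reflects-~ (mulVar v m) n
  coefficient q₂ m | true | ofʸ m·q₂~n = begin
    termˢ (c ℚ.* expVar q₂ n) (divQ₂ n) at m  ≡⟨ termˢ-at-~ _ (proj₁ (mulQ₂-~⇔~-divQ₂ m n) m·q₂~n) ⟩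
    c ℚ.* (half2 n ℚ./ 2)                     ≡⟨ ≡.cong (λ h → c ℚ.* (h ℚ./ 2)) (half2≡ m·q₂~n) ⟨
    c ℚ.* expMulVar q₂ m                      ≡⟨ ℚₚ.*-comm c _ ⟩
    expMulVar q₂ m ℚ.* c                      ∎
    where open ≡.≡-Reasoning
  coefficient (slot a) m | true | ofʸ m·a~n = begin
    termˢ (c ℚ.* expVar (slot a) n) (divSlot a n) at m  ≡⟨ termˢ-at-~ _ (mulSlot-~⇒~-divSlot a m n m·a~n) ⟩
    c ℚ.* ⟦ expAt (exps n) a ⟧                          ≡⟨ ≡.cong (λ e → c ℚ.* ⟦ e ⟧) e≡ ⟩
    c ℚ.* expMulVar (slot a) m                          ≡⟨ ℚₚ.*-comm c _ ⟩
    expMulVar (slot a) m ℚ.* c                          ∎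
    where
    open ≡.≡-Reasoning
    e≡ : expAt (exps n) a ≡ suc (expAt (exps m) a)
    e≡ = ≡.trans (≡.sym (exps≗ m·a~n a)) (at-same incAt-update a (exps m))
  coefficient v m | false | ofⁿ m·v≁n = ≡.trans (vanishes v m·v≁n) (≡.sym (ℚₚ.*-zeroʳ (expMulVar v m)))
    where
    vanishes : ∀ v → ¬ mulVar v m ~ n → termˢ (c ℚ.* expVar v n) (divVar v n) at m ≡ 0ℚ
    vanishes q₂ m·q₂≁n = termˢ-at-≁ _ (m·q₂≁n ∘ proj₂ (mulQ₂-~⇔~-divQ₂ m n))
    vanishes (slot a) m·a≁n with expAt (exps n) a in e≡
    ... | zero  = termˢ-at-0 (divSlot a n) m (≡.trans (≡.cong (c ℚ.*_) ⟦0⟧) (ℚₚ.*-zeroʳ c))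
    ... | suc _ = termˢ-at-≁ _ (m·a≁n ∘ ~-divSlot⇒mulSlot-~ a m n (≡.subst (0 <_) (≡.sym e≡) (s≤s z≤n)))

termOf : ℚ × Mono → Series
termOf (c , n) = termˢ c n

coeffˢ : Poly → Series
coeffˢ p = series (coeff p) (resp p)
  where
  resp : ∀ p {m m′} → m ~ m′ → coeff p m ≡ coeff p m′
  resp []      m~m′ = ≡.refl
  resp (t ∷ p) m~m′ = ≡.cong₂ ℚ._+_ (at-resp (termOf t) m~m′) (resp p m~m′)

coeffˢ-++ : ∀ p q → coeffˢ (p ++ q) ≋ coeffˢ p +ˢ coeffˢ q
coeffˢ-++ []      q = ≋-sym (+ˢ-identityˡ (coeffˢ q))
coeffˢ-++ (t ∷ p) q = ≋-trans (+ˢ-cong (≋-refl {termOf t}) (coeffˢ-++ p q)) (≋-sym (+ˢ-assoc (termOf t) (coeffˢ p) (coeffˢ q)))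

coeffˢ-concatMap : ∀ {A : Set} (f : A → Poly) xs → coeffˢ (concatMap f xs) ≋ ∑ xs (coeffˢ ∘ f)
coeffˢ-concatMap f []       = ≋-refl
coeffˢ-concatMap f (x ∷ xs) = ≋-trans (coeffˢ-++ (f x) (concatMap f xs)) (+ˢ-cong (≋-refl {coeffˢ (f x)}) (coeffˢ-concatMap f xs))

coeffˢ-map : ∀ {L} → IsLinear L → ∀ {f : ℚ × Mono → ℚ × Mono} → (∀ t → termOf (f t) ≋ L (termOf t)) →
             ∀ p → coeffˢ (map f p) ≋ L (coeffˢ p)
coeffˢ-map L-lin f-term []      = ≋-sym (0-homo L-lin)
coeffˢ-map L-lin f-term (t ∷ p) = ≋-trans (+ˢ-cong (f-term t) (coeffˢ-map L-lin f-term p)) (≋-sym (+-homo L-lin (termOf t) (coeffˢ p)))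

coeffˢ-scale : ∀ c p → coeffˢ (scale c p) ≋ c ·ˢ coeffˢ p
coeffˢ-scale c = coeffˢ-map (·ˢ-linear c) λ (d , n) → pointwise λ m → scaled-term d n m
  where
  scaled-term : ∀ d n m → termˢ (c ℚ.* d) n at m ≡ c ℚ.* termˢ d n at m
  scaled-term d n m with eqMono m n
  ... | true  = ≡.refl
  ... | false = ≡.sym (ℚₚ.*-zeroʳ c)

dList-weight : ∀ a c n → c ℚ.* (+ proj₁ (dList a (exps n)) ℚ./ 1) ≡ c ℚ.* expVar (slot a) n
dList-weight a c n = ≡.cong (c ℚ.*_) (≡.trans (≡.sym (⟦n⟧≡n/1 _)) (≡.cong ⟦_⟧ (dList-coefficient a (exps n))))

coeffˢ-∂ : ∀ k p → coeffˢ (∂ k p) ≋ ∂ˢ k (coeffˢ p)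
coeffˢ-∂ zero                = coeffˢ-map 0-linear λ (c , n) → pointwise λ m → termˢ-at-0 n m (ℚₚ.*-zeroʳ c)
coeffˢ-∂ (suc zero)          = coeffˢ-map (∂ᵛ-linear (slot 0)) λ (c , n) →
  ≋-trans (termˢ-cong (dList-weight 0 c n) ~-refl) (termˢ-divVar (slot 0) c n)
coeffˢ-∂ (suc (suc zero))    = coeffˢ-map (∂ᵛ-linear q₂) λ (c , n) → termˢ-divVar q₂ c n
coeffˢ-∂ (suc (suc (suc j))) = coeffˢ-map (∂ᵛ-linear (slot (suc j))) λ (c , n) →
  ≋-trans (termˢ-cong (dList-weight (suc j) c n) ~-refl) (termˢ-divVar (slot (suc j)) c n)

zipAdd-identityʳ : ∀ xs → zipAdd xs [] ≡ xs
zipAdd-identityʳ []       = ≡.refl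
zipAdd-identityʳ (x ∷ xs) = ≡.refl

zipAdd-unit : ∀ a ys → zipAdd (replicate a 0 ++ 1 ∷ []) ys ≡ incAt a ys
zipAdd-unit zero    []       = ≡.refl
zipAdd-unit zero    (y ∷ ys) = ≡.refl
zipAdd-unit (suc a) []       = ≡.cong (0 ∷_) (≡.trans (≡.sym (zipAdd-identityʳ _)) (zipAdd-unit a []))
zipAdd-unit (suc a) (y ∷ ys) = ≡.cong (y ∷_) (zipAdd-unit a ys)

Qv-slot-term : ∀ a d n → termˢ (1ℚ ℚ.* d) (mulMono (mono (+ 0) (replicate a 0 ++ 1 ∷ [])) n) ≋ Xᵛ (slot a) (termˢ d n)
Qv-slot-term a d n =
  ≋-trans (termˢ-cong (ℚₚ.*-identityˡ d) (ℤₚ.+-identityˡ (half2 n) ,~ λ j → ≡.cong (λ xs → expAt xs j) (zipAdd-unit a (exps n))))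
                                 (termˢ-mulVar (slot a) d n)

coeffˢ-monomial-*ᴾ : ∀ {L} → IsLinear L → ∀ c u → (∀ d n → termˢ (c ℚ.* d) (mulMono u n) ≋ L (termˢ d n)) →
                     ∀ p → coeffˢ (((c , u) ∷ []) *ᴾ p) ≋ L (coeffˢ p)
coeffˢ-monomial-*ᴾ L-lin c u u-term []            = ≋-sym (0-homo L-lin)
coeffˢ-monomial-*ᴾ L-lin c u u-term ((d , n) ∷ p) =
  ≋-trans (+ˢ-cong (u-term d n) (coeffˢ-monomial-*ᴾ L-lin c u u-term p)) (≋-sym (+-homo L-lin (termˢ d n) (coeffˢ p)))

coeffˢ-Qv : ∀ l p → coeffˢ (Qv l *ᴾ p) ≋ Qˢ l (coeffˢ p)
coeffˢ-Qv zero                = coeffˢ-monomial-*ᴾ id-linear 1ℚ (mono (+ 0) [])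
  λ d n → termˢ-cong (ℚₚ.*-identityˡ d) (ℤₚ.+-identityˡ (half2 n) ,~ λ _ → ≡.refl)
coeffˢ-Qv (suc zero)          = coeffˢ-monomial-*ᴾ (Xᵛ-linear (slot 0)) 1ℚ (mono (+ 0) (1 ∷ [])) (Qv-slot-term 0)
coeffˢ-Qv (suc (suc zero))    = coeffˢ-monomial-*ᴾ (Xᵛ-linear q₂) 1ℚ (mono (+ 2) [])
  λ d n → ≋-trans (termˢ-cong (ℚₚ.*-identityˡ d) (ℤₚ.+-comm (+ 2) (half2 n) ,~ λ _ → ≡.refl)) (termˢ-mulVar q₂ d n)
coeffˢ-Qv (suc (suc (suc j))) =
  coeffˢ-monomial-*ᴾ (Xᵛ-linear (slot (suc j))) 1ℚ (mono (+ 0) (replicate (suc j) 0 ++ 1 ∷ [])) (Qv-slot-term (suc j))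

∂vecˢ : List ℕ → Series → Series
∂vecˢ []       F = F
∂vecˢ (i ∷ is) F = ∂ˢ (suc i) (∂vecˢ is F)

coeffˢ-∂vec : ∀ is p → coeffˢ (∂vec is p) ≋ ∂vecˢ is (coeffˢ p)
coeffˢ-∂vec []       p = ≋-refl
coeffˢ-∂vec (i ∷ is) p = ≋-trans (coeffˢ-∂ (suc i) (∂vec is p)) (cong (∂ˢ-linear (suc i)) (coeffˢ-∂vec is p))

coeffˢ-𝒟 : ∀ n p → coeffˢ (𝒟 n p) ≋
           ∑ (tuples n (bound p)) (λ is → ⟦ multinom is ⟧ ·ˢ Qˢ (sumℕ is) (∂vecˢ is (coeffˢ p)))
coeffˢ-𝒟 n p = ≋-trans (coeffˢ-concatMap term (tuples n (bound p))) (∑-cong (tuples n (bound p)) λ is →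
  ≋-trans (coeffˢ-scale (+ multinom is ℚ./ 1) (Qv (sumℕ is) *ᴾ ∂vec is p))
    (≋-trans (pointwise λ m → ≡.cong (ℚ._* coeff (Qv (sumℕ is) *ᴾ ∂vec is p) m) (≡.sym (⟦n⟧≡n/1 (multinom is))))
      (·ˢ-cong ⟦ multinom is ⟧ (≋-trans (coeffˢ-Qv (sumℕ is) (∂vec is p)) (cong (Qˢ-linear (sumℕ is)) (coeffˢ-∂vec is p))))))
  where
  term : List ℕ → Poly
  term is = scale (+ multinom is ℚ./ 1) (Qv (sumℕ is) *ᴾ ∂vec is p)

ConstantBeyond : ℕ → Series → Set
ConstantBeyond N F = ∀ i → N ≤ i → ∂ˢ (suc i) F ≋ 0ˢ

expAt-beyond : ∀ xs j → length xs ≤ j → expAt xs j ≡ 0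
expAt-beyond []       j       _         = ≡.refl
expAt-beyond (x ∷ xs) (suc j) (s≤s len≤j) = expAt-beyond xs j len≤j

3≤bound : ∀ p → 3 ≤ bound p
3≤bound []            = ℕₚ.≤-refl
3≤bound ((c , n) ∷ p) = ℕₚ.m≤n⇒m≤o⊔n (length (exps n) + 3) (3≤bound p)

coeff-vanishes-beyond : ∀ p m j → bound p ≤ j + 3 → 0 < expAt (exps m) j → coeff p m ≡ 0ℚ
coeff-vanishes-beyond []            m j _        _   = ≡.refl
coeff-vanishes-beyond ((c , n) ∷ p) m j bound≤j+3 0<e =
  ≡.trans (≡.cong₂ ℚ._+_ (termˢ-at-≁ c {n} {m} m≁n) (coeff-vanishes-beyond p m j bound′≤j+3 0<e)) (ℚₚ.+-identityˡ 0ℚ)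
  where
  bound′≤j+3 : bound p ≤ j + 3
  bound′≤j+3 = ℕₚ.≤-trans (ℕₚ.m≤n⊔m (length (exps n) + 3) (bound p)) bound≤j+3
  len≤j : length (exps n) ≤ j
  len≤j = ℕₚ.+-cancelʳ-≤ 3 (length (exps n)) j (ℕₚ.≤-trans (ℕₚ.m≤m⊔n (length (exps n) + 3) (bound p)) bound≤j+3)
  m≁n : ¬ m ~ n
  m≁n m~n = ℕₚ.<⇒≢ 0<e (≡.sym (≡.trans (exps≗ m~n j) (expAt-beyond (exps n) j len≤j)))

coeffˢ-constantBeyond : ∀ p → ConstantBeyond (bound p) (coeffˢ p)
coeffˢ-constantBeyond p zero          bound≤0 = contradiction (ℕₚ.≤-trans (3≤bound p) bound≤0) λ ()
coeffˢ-constantBeyond p (suc zero)    bound≤1 = contradiction (ℕₚ.≤-trans (3≤bound p) bound≤1) λ { (s≤s ()) }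
coeffˢ-constantBeyond p (suc (suc k)) bound≤k+2 = pointwise λ m →
  ≡.trans (≡.cong (expMulVar (slot (suc k)) m ℚ.*_) (coeff-vanishes-beyond p (mulSlot (suc k) m) (suc k) bound≤k+4 (0<e m)))
          (ℚₚ.*-zeroʳ (expMulVar (slot (suc k)) m))
  where
  bound≤k+4 : bound p ≤ suc k + 3
  bound≤k+4 = ℕₚ.≤-trans bound≤k+2 (ℕₚ.≤-trans (ℕₚ.m≤m+n (suc (suc k)) 2) (ℕₚ.≤-reflexive (≡.sym (ℕₚ.+-suc (suc k) 2))))
  0<e : ∀ m → 0 < expAt (exps (mulSlot (suc k) m)) (suc k)
  0<e m = ≡.subst (0 <_) (≡.sym (at-same incAt-update (suc k) (exps m))) (s≤s z≤n)

-- The operators ℒ n k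

-- ℒ n k = k! [tᵏ] 𝐋(t)ⁿ; the recursion splits off one factor 𝐋(t).
ℒ : ℕ → ℕ → Series → Series
ℒ zero    zero    F = F
ℒ zero    (suc k) F = 0ˢ
ℒ (suc n) k       F = ∑< (suc k) (λ i → ⟦ k C i ⟧ ·ˢ ∂ˢ (suc i) (ℒ n (k ∸ i) F))

ℒ-linear : ∀ n k → IsLinear (ℒ n k)
ℒ-linear zero    zero    = id-linear
ℒ-linear zero    (suc k) = 0-linear
ℒ-linear (suc n) k       = ∑<-pointwise-linear (suc k) λ i →
  ∘-linear (·ˢ-linear ⟦ k C i ⟧) (∘-linear (∂ˢ-linear (suc i)) (ℒ-linear n (k ∸ i)))

ℒ-comm : ∀ {L} → IsLinear L → (∀ j F → L (∂ˢ j F) ≋ ∂ˢ j (L F)) → ∀ n k F → ℒ n k (L F) ≋ L (ℒ n k F)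
ℒ-comm L-lin L-∂ zero    zero    F = ≋-refl
ℒ-comm L-lin L-∂ zero    (suc k) F = ≋-sym (0-homo L-lin)
ℒ-comm {L} L-lin L-∂ (suc n) k F = begin
  ∑< (suc k) (λ i → ⟦ k C i ⟧ ·ˢ ∂ˢ (suc i) (ℒ n (k ∸ i) (L F)))
    ≈⟨ ∑<-cong (suc k) (λ i → ·ˢ-cong ⟦ k C i ⟧ (≋-trans (cong (∂ˢ-linear (suc i)) (ℒ-comm L-lin L-∂ n (k ∸ i) F))
                                                           (≋-sym (L-∂ (suc i) (ℒ n (k ∸ i) F))))) ⟩
  ∑< (suc k) (λ i → ⟦ k C i ⟧ ·ˢ L (∂ˢ (suc i) (ℒ n (k ∸ i) F)))
    ≈⟨ ∑<-·ˢ-linear L-lin (suc k) (λ i → ⟦ k C i ⟧) (λ i → ∂ˢ (suc i) (ℒ n (k ∸ i) F)) ⟨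
  L (ℒ (suc n) k F) ∎
  where open SeriesReasoning

ℒ-∂ˢ : ∀ n k j F → ℒ n k (∂ˢ j F) ≋ ∂ˢ j (ℒ n k F)
ℒ-∂ˢ n k j = ℒ-comm (∂ˢ-linear j) (∂ˢ-comm j) n k

ℒ-ℒ : ∀ n k m l F → ℒ n k (ℒ m l F) ≋ ℒ m l (ℒ n k F)
ℒ-ℒ n k m l = ℒ-comm (ℒ-linear m l) (ℒ-∂ˢ m l) n k

ℒ-constantBeyond : ∀ {N F} n k → ConstantBeyond N F → ConstantBeyond N (ℒ n k F)
ℒ-constantBeyond {F = F} n k F-const i N≤i =
  ≋-trans (≋-sym (ℒ-∂ˢ n k (suc i) F)) (linear-vanishes (ℒ-linear n k) (F-const i N≤i))

-- Once k > n * N, every term of ℒ n k contains some ∂_{i+1} with N ≤ i.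
ℒ-vanishes : ∀ {N F} → ConstantBeyond N F → ∀ n k → n * N < k → ℒ n k F ≋ 0ˢ
ℒ-vanishes F-const zero    (suc k) _ = ≋-refl
ℒ-vanishes {N} {F} F-const (suc n) k N+n*N<k = ∑<-zero (suc k) λ i _ → linear-vanishes (·ˢ-linear ⟦ k C i ⟧) (term i)
  where
  term : ∀ i → ∂ˢ (suc i) (ℒ n (k ∸ i) F) ≋ 0ˢ
  term i with ℕₚ.≤-<-connex N i
  ... | inj₁ N≤i = ℒ-constantBeyond n (k ∸ i) F-const i N≤i
  ... | inj₂ i<N = linear-vanishes (∂ˢ-linear (suc i)) (ℒ-vanishes F-const n (k ∸ i) n*N<k∸i)
    where
    n*N<k∸i : n * N < k ∸ i
    n*N<k∸i = ℕₚ.≤-trans (ℕₚ.m+n≤o⇒m≤o∸n (suc (n * N)) (ℕₚ.≤-trans (ℕₚ.≤-reflexive (ℕₚ.+-comm (suc (n * N)) N))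
                                                     (ℕₚ.≤-trans (ℕₚ.≤-reflexive (ℕₚ.+-suc N (n * N))) N+n*N<k)))
                         (ℕₚ.∸-monoʳ-≤ k (ℕₚ.<⇒≤ i<N))

-- Each of the n + 1 factors 𝐋(t) of ℒ (n + 1) k may hit Q_{l+1} through its term tˡ/l! ∂_{l+1}, leaving (k C l) ℒ n (k ∸ l).
[ℒ,Q] : ℕ → ℕ → ℕ → Series → Series
[ℒ,Q] zero    k l       H = 0ˢ
[ℒ,Q] (suc n) k zero    H = 0ˢ
[ℒ,Q] (suc n) k (suc l) H = ⟦ suc n * (k C l) ⟧ ·ˢ ℒ n (k ∸ l) H

[ℒ,Q]-linear : ∀ n k l → IsLinear ([ℒ,Q] n k l)
[ℒ,Q]-linear zero    k l       = 0-linear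
[ℒ,Q]-linear (suc n) k zero    = 0-linear
[ℒ,Q]-linear (suc n) k (suc l) = ∘-linear (·ˢ-linear ⟦ suc n * (k C l) ⟧) (ℒ-linear n (k ∸ l))

∑<-∂ˢ-[ℒ,Q] : ∀ n k l H →
              ∑< (suc k) (λ i → ⟦ k C i ⟧ ·ˢ ∂ˢ (suc i) ([ℒ,Q] n (k ∸ i) (suc l) H)) ≋ ⟦ n * (k C l) ⟧ ·ˢ ℒ n (k ∸ l) H
∑<-∂ˢ-[ℒ,Q] zero k l H = ≋-trans (∑<-zero (suc k) λ i _ → linear-vanishes (·ˢ-linear ⟦ k C i ⟧) (0-homo (∂ˢ-linear (suc i))))
                                 (≋-sym (⟦0⟧·ˢ (ℒ zero (k ∸ l) H)))
∑<-∂ˢ-[ℒ,Q] (suc n) k l H = begin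
  ∑< (suc k) (λ i → ⟦ k C i ⟧ ·ˢ ∂ˢ (suc i) (⟦ c i ⟧ ·ˢ ℒ n (k ∸ i ∸ l) H))
    ≈⟨ ∑<-cong (suc k) term ⟩
  ∑< (suc k) (λ i → ⟦ suc n * (k C l) ⟧ ·ˢ Y i)
    ≈⟨ ∑<-linear (·ˢ-linear ⟦ suc n * (k C l) ⟧) (suc k) Y ⟨
  ⟦ suc n * (k C l) ⟧ ·ˢ ∑< (suc k) Y
    ≈⟨ ·ˢ-cong ⟦ suc n * (k C l) ⟧ (∑<-truncate Y (λ i k∸l<i → ⟦nCk⟧·ˢ-vanishes _ k∸l<i) (s≤s (ℕₚ.m∸n≤m k l))) ⟩
  ⟦ suc n * (k C l) ⟧ ·ˢ ℒ (suc n) (k ∸ l) H ∎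
  where
  open SeriesReasoning
  c : ℕ → ℕ
  c i = suc n * ((k ∸ i) C l)
  Y : ℕ → Series
  Y i = ⟦ (k ∸ l) C i ⟧ ·ˢ ∂ˢ (suc i) (ℒ n (k ∸ l ∸ i) H)
  coefficients : ∀ i → (k C i) * c i ≡ suc n * (k C l) * ((k ∸ l) C i)
  coefficients i = ≡.trans (ℕ*.x∙yz≈y∙xz (k C i) (suc n) _)
                   (≡.trans (≡.cong (suc n *_) (nCi*[n∸i]Cj≡nCj*[n∸j]Ci k i l)) (≡.sym (ℕₚ.*-assoc (suc n) (k C l) _)))
  term : ∀ i → ⟦ k C i ⟧ ·ˢ ∂ˢ (suc i) (⟦ c i ⟧ ·ˢ ℒ n (k ∸ i ∸ l) H) ≋ ⟦ suc n * (k C l) ⟧ ·ˢ Y i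
  term i = begin
    ⟦ k C i ⟧ ·ˢ ∂ˢ (suc i) (⟦ c i ⟧ ·ˢ ℒ n (k ∸ i ∸ l) H)
      ≈⟨ ⟦⟧·ˢ-pull (∂ˢ-linear (suc i)) (k C i) (c i) (ℒ n (k ∸ i ∸ l) H) ⟩
    ⟦ (k C i) * c i ⟧ ·ˢ ∂ˢ (suc i) (ℒ n (k ∸ i ∸ l) H)
      ≈⟨ ⟦⟧·ˢ-cong (coefficients i) (cong (∂ˢ-linear (suc i)) (≡⇒≋ (≡.cong (λ x → ℒ n x H) (∸-comm k i l)))) ⟩
    ⟦ suc n * (k C l) * ((k ∸ l) C i) ⟧ ·ˢ ∂ˢ (suc i) (ℒ n (k ∸ l ∸ i) H)
      ≈⟨ ⟦⟧·ˢ-assoc (suc n * (k C l)) ((k ∸ l) C i) _ ⟨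
    ⟦ suc n * (k C l) ⟧ ·ˢ Y i ∎

ℒ-Qˢ : ∀ n k l H → ℒ n k (Qˢ l H) ≋ Qˢ l (ℒ n k H) +ˢ [ℒ,Q] n k l H
ℒ-Qˢ zero    zero    l       H = ≋-sym (+ˢ-identityʳ (Qˢ l H))
ℒ-Qˢ zero    (suc k) l       H = ≋-sym (≋-trans (+ˢ-identityʳ _) (0-homo (Qˢ-linear l)))
ℒ-Qˢ (suc n) k       zero    H = ≋-sym (+ˢ-identityʳ _)
ℒ-Qˢ (suc n) k       (suc l) H = begin
  ℒ (suc n) k (Qˢ (suc l) H)
    ≈⟨ ∑<-cong (suc k) (λ i → ·ˢ-cong ⟦ k C i ⟧ (expand i)) ⟩
  ∑< (suc k) (λ i → ⟦ k C i ⟧ ·ˢ (A i +ˢ B i +ˢ D i))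
    ≈⟨ ≋-trans (∑<-·ˢ-distrib (suc k) c (λ i → A i +ˢ B i) D) (+ˢ-cong (∑<-·ˢ-distrib (suc k) c A B) ≋-refl) ⟩
  ∑< (suc k) (λ i → ⟦ k C i ⟧ ·ˢ A i) +ˢ ∑< (suc k) (λ i → ⟦ k C i ⟧ ·ˢ B i) +ˢ ∑< (suc k) (λ i → ⟦ k C i ⟧ ·ˢ D i)
    ≈⟨ +ˢ-cong (+ˢ-cong A-part B-part) (∑<-∂ˢ-[ℒ,Q] n k l H) ⟩
  Qˢ (suc l) (ℒ (suc n) k H) +ˢ ⟦ k C l ⟧ ·ˢ X l +ˢ ⟦ n * (k C l) ⟧ ·ˢ X l
    ≈⟨ +ˢ-assoc _ _ _ ⟩
  Qˢ (suc l) (ℒ (suc n) k H) +ˢ (⟦ k C l ⟧ ·ˢ X l +ˢ ⟦ n * (k C l) ⟧ ·ˢ X l)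
    ≈⟨ +ˢ-cong (≋-refl {Qˢ (suc l) (ℒ (suc n) k H)}) (≋-sym (⟦⟧·ˢ-distrib (k C l) (n * (k C l)) (X l))) ⟩
  Qˢ (suc l) (ℒ (suc n) k H) +ˢ [ℒ,Q] (suc n) k (suc l) H ∎
  where
  open SeriesReasoning
  c : ℕ → ℚ
  c i = ⟦ k C i ⟧
  X : ℕ → Series
  X i = ℒ n (k ∸ i) H
  A B D : ℕ → Series
  A i = Qˢ (suc l) (∂ˢ (suc i) (X i))
  B i = δˢ i l (X i)
  D i = ∂ˢ (suc i) ([ℒ,Q] n (k ∸ i) (suc l) H)
  expand : ∀ i → ∂ˢ (suc i) (ℒ n (k ∸ i) (Qˢ (suc l) H)) ≋ A i +ˢ B i +ˢ D i
  expand i = begin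
    ∂ˢ (suc i) (ℒ n (k ∸ i) (Qˢ (suc l) H))
      ≈⟨ cong (∂ˢ-linear (suc i)) (ℒ-Qˢ n (k ∸ i) (suc l) H) ⟩
    ∂ˢ (suc i) (Qˢ (suc l) (X i) +ˢ [ℒ,Q] n (k ∸ i) (suc l) H)
      ≈⟨ +-homo (∂ˢ-linear (suc i)) (Qˢ (suc l) (X i)) ([ℒ,Q] n (k ∸ i) (suc l) H) ⟩
    ∂ˢ (suc i) (Qˢ (suc l) (X i)) +ˢ D i
      ≈⟨ +ˢ-cong (∂ˢ-Qˢ i l (X i)) ≋-refl ⟩
    A i +ˢ B i +ˢ D i ∎
  A-part : ∑< (suc k) (λ i → ⟦ k C i ⟧ ·ˢ A i) ≋ Qˢ (suc l) (ℒ (suc n) k H)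
  A-part = ≋-sym (∑<-·ˢ-linear (Qˢ-linear (suc l)) (suc k) c (λ i → ∂ˢ (suc i) (X i)))
  B-part : ∑< (suc k) (λ i → ⟦ k C i ⟧ ·ˢ B i) ≋ ⟦ k C l ⟧ ·ˢ X l
  B-part = ≋-trans (∑<-delta (suc k) l _ (λ i _ i≢l → linear-vanishes (·ˢ-linear ⟦ k C i ⟧) (δˢ-other i≢l (X i)))
                                        (λ k<l → ⟦nCk⟧·ˢ-vanishes _ k<l))
                   (·ˢ-cong ⟦ k C l ⟧ (δˢ-same l (X l)))

ℒ-zero-vanishes : ∀ k j G → j < k → ℒ 0 (k ∸ j) G ≋ 0ˢ
ℒ-zero-vanishes k j G j<k rewrite ℕₚ.+-∸-assoc 1 j<k = ≋-refl

-- The generating-function identity 𝐋(t)^a 𝐋(t)^b = 𝐋(t)^(a+b) read off at t^k / k!.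
ℒ-+ : ∀ a b k F → ∑< (suc k) (λ j → ⟦ k C j ⟧ ·ˢ ℒ a (k ∸ j) (ℒ b j F)) ≋ ℒ (a + b) k F
ℒ-+ zero b k F = ≋-trans (∑<-delta (suc k) k _ off (λ k<k → contradiction k<k (ℕₚ.<-irrefl ≡.refl))) diagonal
  where
  off : ∀ j → j < suc k → j ≢ k → ⟦ k C j ⟧ ·ˢ ℒ 0 (k ∸ j) (ℒ b j F) ≋ 0ˢ
  off j j<1+k j≢k = linear-vanishes (·ˢ-linear ⟦ k C j ⟧) (ℒ-zero-vanishes k j (ℒ b j F) (ℕₚ.≤∧≢⇒< (ℕₚ.≤-pred j<1+k) j≢k))
  diagonal : ⟦ k C k ⟧ ·ˢ ℒ 0 (k ∸ k) (ℒ b k F) ≋ ℒ b k F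
  diagonal rewrite nCn≡1 k | ℕₚ.n∸n≡0 k = ⟦1⟧·ˢ (ℒ b k F)
ℒ-+ (suc a) b k F = begin
  ∑< (suc k) (λ j → ⟦ k C j ⟧ ·ˢ ℒ (suc a) (k ∸ j) (ℒ b j F))
    ≈⟨ ∑<-cong (suc k) (λ j → ⟦⟧·ˢ-∑<-pull id-linear (k C j) (suc (k ∸ j)) ((k ∸ j) C_) (g j)) ⟩
  ∑< (suc k) (λ j → ∑< (suc (k ∸ j)) (λ i → ⟦ (k C j) * ((k ∸ j) C i) ⟧ ·ˢ g j i))
    ≈⟨ ∑<-binomial-comm k g ⟩
  ∑< (suc k) (λ i → ∑< (suc (k ∸ i)) (λ j → ⟦ (k C i) * ((k ∸ i) C j) ⟧ ·ˢ g j i))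
    ≈⟨ ∑<-cong (suc k) (λ i → ⟦⟧·ˢ-∑<-pull (∂ˢ-linear (suc i)) (k C i) (suc (k ∸ i)) ((k ∸ i) C_) (λ j → ℒ a (k ∸ j ∸ i) (ℒ b j F))) ⟨
  ∑< (suc k) (λ i → ⟦ k C i ⟧ ·ˢ ∂ˢ (suc i) (∑< (suc (k ∸ i)) (λ j → ⟦ (k ∸ i) C j ⟧ ·ˢ ℒ a (k ∸ j ∸ i) (ℒ b j F))))
    ≈⟨ ∑<-cong (suc k) (λ i → ·ˢ-cong ⟦ k C i ⟧ (cong (∂ˢ-linear (suc i)) (inner i))) ⟩
  ℒ (suc (a + b)) k F ∎
  where
  open SeriesReasoning
  g : ℕ → ℕ → Series
  g j i = ∂ˢ (suc i) (ℒ a (k ∸ j ∸ i) (ℒ b j F))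
  inner : ∀ i → ∑< (suc (k ∸ i)) (λ j → ⟦ (k ∸ i) C j ⟧ ·ˢ ℒ a (k ∸ j ∸ i) (ℒ b j F)) ≋ ℒ (a + b) (k ∸ i) F
  inner i = ≋-trans (∑<-cong (suc (k ∸ i)) λ j → ·ˢ-cong ⟦ (k ∸ i) C j ⟧ (≡⇒≋ (≡.cong (λ x → ℒ a x (ℒ b j F)) (∸-comm k j i))))
                    (ℒ-+ a b (k ∸ i) F)

-- ℒ′ b j = j! [tʲ] 𝐋ᵇ 𝐋′ and ℒ′-rest b j = j! [tʲ] (𝐋ᵇ)′ 𝐋.
ℒ′ ℒ′-rest : ℕ → ℕ → Series → Series
ℒ′      b j F = ∑< (suc j) (λ i → ⟦ j C i ⟧ ·ˢ ∂ˢ (suc (suc i)) (ℒ b (j ∸ i) F))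
ℒ′-rest b j F = ∑< (suc j) (λ i → ⟦ j C i ⟧ ·ˢ ∂ˢ (suc i) (ℒ b (suc j ∸ i) F))

ℒ-Leibniz : ∀ b j F → ℒ (suc b) (suc j) F ≋ ℒ′-rest b j F +ˢ ℒ′ b j F
ℒ-Leibniz b j F = begin
  ℒ (suc b) (suc j) F
    ≈⟨ ∑<-suc (suc j) f ⟩
  f 0 +ˢ ∑< (suc j) (f ∘ suc)
    ≈⟨ +ˢ-cong (≋-refl {f 0}) (≋-trans (∑<-cong (suc j) pascal) (∑<-distrib (suc j) _ _)) ⟩
  f 0 +ˢ (∑< (suc j) (λ i → ⟦ j C suc i ⟧ ·ˢ Y i) +ˢ ℒ′ b j F)
    ≈⟨ +ˢ-assoc _ _ _ ⟨
  f 0 +ˢ ∑< (suc j) (λ i → ⟦ j C suc i ⟧ ·ˢ Y i) +ˢ ℒ′ b j F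
    ≈⟨ +ˢ-cong rest ≋-refl ⟩
  ℒ′-rest b j F +ˢ ℒ′ b j F ∎
  where
  open SeriesReasoning
  f : ℕ → Series
  f i = ⟦ suc j C i ⟧ ·ˢ ∂ˢ (suc i) (ℒ b (suc j ∸ i) F)
  Y : ℕ → Series
  Y i = ∂ˢ (suc (suc i)) (ℒ b (j ∸ i) F)
  pascal : ∀ i → f (suc i) ≋ ⟦ j C suc i ⟧ ·ˢ Y i +ˢ ⟦ j C i ⟧ ·ˢ Y i
  pascal i = ≋-trans (⟦⟧·ˢ-cong (≡.trans (≡.sym (nCk+nC[k+1]≡[n+1]C[k+1] j i)) (ℕₚ.+-comm (j C i) _)) ≋-refl)
                     (⟦⟧·ˢ-distrib (j C suc i) (j C i) (Y i))
  g : ℕ → Series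
  g i = ⟦ j C i ⟧ ·ˢ ∂ˢ (suc i) (ℒ b (suc j ∸ i) F)
  rest : f 0 +ˢ ∑< (suc j) (λ i → ⟦ j C suc i ⟧ ·ˢ Y i) ≋ ℒ′-rest b j F
  rest = ≋-sym (≋-trans (∑<-extend (suc j) (suc (suc j)) g (λ i j<i → ⟦nCk⟧·ˢ-vanishes _ j<i) ℕₚ.≤-refl (ℕₚ.n≤1+n (suc j)))
                        (∑<-suc (suc j) g))

mutual
  -- The chain rule (𝐋ᵇ⁺¹)′ = (b + 1) 𝐋ᵇ 𝐋′.
  ℒ-suc-suc : ∀ b j F → ℒ (suc b) (suc j) F ≋ ⟦ suc b ⟧ ·ˢ ℒ′ b j F
  ℒ-suc-suc b j F = ≋-trans (ℒ-Leibniz b j F) (≋-trans (+ˢ-cong (ℒ′-rest≈b·ℒ′ b j F) ≋-refl)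
    (pointwise λ m → ≡.trans (≡.sym ([x+1]*y≡x*y+y ⟦ b ⟧ (ℒ′ b j F at m)))
                             (≡.cong (ℚ._* ℒ′ b j F at m) (≡.sym (⟦suc⟧ b)))))

  ℒ′-rest≈b·ℒ′ : ∀ b j F → ℒ′-rest b j F ≋ ⟦ b ⟧ ·ˢ ℒ′ b j F
  ℒ′-rest≈b·ℒ′ zero j F = ≋-trans (∑<-zero (suc j) term) (≋-sym (⟦0⟧·ˢ (ℒ′ zero j F)))
    where
    term : ∀ i → i < suc j → ⟦ j C i ⟧ ·ˢ ∂ˢ (suc i) (ℒ zero (suc j ∸ i) F) ≋ 0ˢ
    term i i<1+j = linear-vanishes (∘-linear (·ˢ-linear ⟦ j C i ⟧) (∂ˢ-linear (suc i))) (ℒ-zero-vanishes (suc j) i F i<1+j)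
  ℒ′-rest≈b·ℒ′ (suc b) j F = begin
    ℒ′-rest (suc b) j F
      ≈⟨ ∑<-cong-< (suc j) factor ⟩
    ∑< (suc j) (λ i → ⟦ suc b ⟧ ·ˢ ⟦ j C i ⟧ ·ˢ ∂ˢ (suc i) (ℒ′ b (j ∸ i) F))
      ≈⟨ ∑<-linear (·ˢ-linear ⟦ suc b ⟧) (suc j) (λ i → ⟦ j C i ⟧ ·ˢ ∂ˢ (suc i) (ℒ′ b (j ∸ i) F)) ⟨
    ⟦ suc b ⟧ ·ˢ ∑< (suc j) (λ i → ⟦ j C i ⟧ ·ˢ ∂ˢ (suc i) (ℒ′ b (j ∸ i) F))
      ≈⟨ ·ˢ-cong ⟦ suc b ⟧ (begin
        ∑< (suc j) (λ i → ⟦ j C i ⟧ ·ˢ ∂ˢ (suc i) (ℒ′ b (j ∸ i) F))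
          ≈⟨ ∑<-cong (suc j) (λ i → ⟦⟧·ˢ-∑<-pull (∂ˢ-linear (suc i)) (j C i) (suc (j ∸ i)) ((j ∸ i) C_)
                                                  λ i′ → ∂ˢ (suc (suc i′)) (ℒ b (j ∸ i ∸ i′) F)) ⟩
        ∑< (suc j) (λ i → ∑< (suc (j ∸ i)) (λ i′ → ⟦ (j C i) * ((j ∸ i) C i′) ⟧ ·ˢ g i i′))
          ≈⟨ ∑<-binomial-comm j g ⟩
        ∑< (suc j) (λ i′ → ∑< (suc (j ∸ i′)) (λ i → ⟦ (j C i′) * ((j ∸ i′) C i) ⟧ ·ˢ g i i′))
          ≈⟨ ∑<-cong (suc j) (λ i′ → ∑<-cong (suc (j ∸ i′)) λ i → ·ˢ-cong ⟦ (j C i′) * ((j ∸ i′) C i) ⟧ (swap i i′)) ⟩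
        ∑< (suc j) (λ i′ → ∑< (suc (j ∸ i′)) (λ i → ⟦ (j C i′) * ((j ∸ i′) C i) ⟧ ·ˢ ∂ˢ (suc (suc i′)) (∂ˢ (suc i) (ℒ b (j ∸ i′ ∸ i) F))))
          ≈⟨ ∑<-cong (suc j) (λ i′ → ⟦⟧·ˢ-∑<-pull (∂ˢ-linear (suc (suc i′))) (j C i′) (suc (j ∸ i′)) ((j ∸ i′) C_)
                                                    λ i → ∂ˢ (suc i) (ℒ b (j ∸ i′ ∸ i) F)) ⟨
        ℒ′ (suc b) j F ∎) ⟩
    ⟦ suc b ⟧ ·ˢ ℒ′ (suc b) j F ∎
    where
    open SeriesReasoning
    g : ℕ → ℕ → Series
    g i i′ = ∂ˢ (suc i) (∂ˢ (suc (suc i′)) (ℒ b (j ∸ i ∸ i′) F))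
    swap : ∀ i i′ → g i i′ ≋ ∂ˢ (suc (suc i′)) (∂ˢ (suc i) (ℒ b (j ∸ i′ ∸ i) F))
    swap i i′ = ≋-trans (∂ˢ-comm (suc i) (suc (suc i′)) (ℒ b (j ∸ i ∸ i′) F))
                        (cong (∘-linear (∂ˢ-linear (suc (suc i′))) (∂ˢ-linear (suc i))) (≡⇒≋ (≡.cong (λ x → ℒ b x F) (∸-comm j i i′))))
    factor : ∀ i → i < suc j →
             ⟦ j C i ⟧ ·ˢ ∂ˢ (suc i) (ℒ (suc b) (suc j ∸ i) F) ≋ ⟦ suc b ⟧ ·ˢ ⟦ j C i ⟧ ·ˢ ∂ˢ (suc i) (ℒ′ b (j ∸ i) F)
    factor i (s≤s i≤j) rewrite ℕₚ.+-∸-assoc 1 i≤j = begin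
      ⟦ j C i ⟧ ·ˢ ∂ˢ (suc i) (ℒ (suc b) (suc (j ∸ i)) F)
        ≈⟨ ·ˢ-cong ⟦ j C i ⟧ (cong (∂ˢ-linear (suc i)) (ℒ-suc-suc b (j ∸ i) F)) ⟩
      ⟦ j C i ⟧ ·ˢ ∂ˢ (suc i) (⟦ suc b ⟧ ·ˢ ℒ′ b (j ∸ i) F)
        ≈⟨ ⟦⟧·ˢ-pull (∂ˢ-linear (suc i)) (j C i) (suc b) (ℒ′ b (j ∸ i) F) ⟩
      ⟦ (j C i) * suc b ⟧ ·ˢ ∂ˢ (suc i) (ℒ′ b (j ∸ i) F)
        ≈⟨ ⟦⟧·ˢ-cong (ℕₚ.*-comm (j C i) (suc b)) ≋-refl ⟩
      ⟦ suc b * (j C i) ⟧ ·ˢ ∂ˢ (suc i) (ℒ′ b (j ∸ i) F)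
        ≈⟨ ⟦⟧·ˢ-assoc (suc b) (j C i) (∂ˢ (suc i) (ℒ′ b (j ∸ i) F)) ⟨
      ⟦ suc b ⟧ ·ˢ ⟦ j C i ⟧ ·ˢ ∂ˢ (suc i) (ℒ′ b (j ∸ i) F) ∎

commutatorSum : ℕ → ℕ → ℕ → Series → Series
commutatorSum a b k F = ∑< (suc k) (λ j → ⟦ suc a * (k C j) ⟧ ·ˢ ℒ a (k ∸ j) (ℒ (suc b) (suc j) F))

commutatorSum-closed : ∀ a b k F → commutatorSum a b k F ≋ ⟦ suc a * suc b ⟧ ·ˢ ℒ′ (a + b) k F
commutatorSum-closed a b k F = begin
  commutatorSum a b k F
    ≈⟨ ∑<-cong (suc k) term ⟩
  ∑< (suc k) (λ j → ⟦ c ⟧ ·ˢ ∑< (suc j) (g j))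
    ≈⟨ ∑<-linear (·ˢ-linear ⟦ c ⟧) (suc k) (λ j → ∑< (suc j) (g j)) ⟨
  ⟦ c ⟧ ·ˢ ∑< (suc k) (λ j → ∑< (suc j) (g j))
    ≈⟨ ·ˢ-cong ⟦ c ⟧ (≋-trans (∑<-triangle k g) (∑<-cong (suc k) inner)) ⟩
  ⟦ c ⟧ ·ˢ ℒ′ (a + b) k F ∎
  where
  open SeriesReasoning
  c = suc a * suc b
  g : ℕ → ℕ → Series
  g j i = ⟦ (k C j) * (j C i) ⟧ ·ˢ ℒ a (k ∸ j) (∂ˢ (suc (suc i)) (ℒ b (j ∸ i) F))
  coefficient : ∀ j → suc a * (k C j) * suc b ≡ c * (k C j)
  coefficient j = ℕ-solve 3 (λ A K B → A :* K :* B := (A :* B) :* K) ≡.refl (suc a) (k C j) (suc b)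
    where open ℕSolver using (_:*_; _:=_) renaming (solve to ℕ-solve)
  term : ∀ j → ⟦ suc a * (k C j) ⟧ ·ˢ ℒ a (k ∸ j) (ℒ (suc b) (suc j) F) ≋ ⟦ c ⟧ ·ˢ ∑< (suc j) (g j)
  term j = begin
    ⟦ suc a * (k C j) ⟧ ·ˢ ℒ a (k ∸ j) (ℒ (suc b) (suc j) F)
      ≈⟨ ·ˢ-cong ⟦ suc a * (k C j) ⟧ (cong (ℒ-linear a (k ∸ j)) (ℒ-suc-suc b j F)) ⟩
    ⟦ suc a * (k C j) ⟧ ·ˢ ℒ a (k ∸ j) (⟦ suc b ⟧ ·ˢ ℒ′ b j F)
      ≈⟨ ⟦⟧·ˢ-pull (ℒ-linear a (k ∸ j)) (suc a * (k C j)) (suc b) (ℒ′ b j F) ⟩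
    ⟦ suc a * (k C j) * suc b ⟧ ·ˢ ℒ a (k ∸ j) (ℒ′ b j F)
      ≈⟨ ≋-trans (⟦⟧·ˢ-cong (coefficient j) ≋-refl) (≋-sym (⟦⟧·ˢ-assoc c (k C j) (ℒ a (k ∸ j) (ℒ′ b j F)))) ⟩
    ⟦ c ⟧ ·ˢ ⟦ k C j ⟧ ·ˢ ℒ a (k ∸ j) (ℒ′ b j F)
      ≈⟨ ·ˢ-cong ⟦ c ⟧ (⟦⟧·ˢ-∑<-pull (ℒ-linear a (k ∸ j)) (k C j) (suc j) (j C_) (λ i → ∂ˢ (suc (suc i)) (ℒ b (j ∸ i) F))) ⟩
    ⟦ c ⟧ ·ˢ ∑< (suc j) (g j) ∎
  inner : ∀ i → ∑< (suc (k ∸ i)) (λ j → g (i + j) i) ≋ ⟦ k C i ⟧ ·ˢ ∂ˢ (suc (suc i)) (ℒ (a + b) (k ∸ i) F)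
  inner i = begin
    ∑< (suc (k ∸ i)) (λ j → g (i + j) i)
      ≈⟨ ∑<-cong (suc (k ∸ i)) reindex ⟩
    ∑< (suc (k ∸ i)) (λ j → ⟦ (k C i) * ((k ∸ i) C j) ⟧ ·ˢ ∂ˢ (suc (suc i)) (ℒ a (k ∸ i ∸ j) (ℒ b j F)))
      ≈⟨ ⟦⟧·ˢ-∑<-pull (∂ˢ-linear (suc (suc i))) (k C i) (suc (k ∸ i)) ((k ∸ i) C_) (λ j → ℒ a (k ∸ i ∸ j) (ℒ b j F)) ⟨
    ⟦ k C i ⟧ ·ˢ ∂ˢ (suc (suc i)) (∑< (suc (k ∸ i)) (λ j → ⟦ (k ∸ i) C j ⟧ ·ˢ ℒ a (k ∸ i ∸ j) (ℒ b j F)))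
      ≈⟨ ·ˢ-cong ⟦ k C i ⟧ (cong (∂ˢ-linear (suc (suc i))) (ℒ-+ a b (k ∸ i) F)) ⟩
    ⟦ k C i ⟧ ·ˢ ∂ˢ (suc (suc i)) (ℒ (a + b) (k ∸ i) F) ∎
    where
    reindex : ∀ j → g (i + j) i ≋ ⟦ (k C i) * ((k ∸ i) C j) ⟧ ·ˢ ∂ˢ (suc (suc i)) (ℒ a (k ∸ i ∸ j) (ℒ b j F))
    reindex j = ⟦⟧·ˢ-cong (nC[i+j]*[i+j]Ci≡nCi*[n∸i]Cj k i j) (begin
      ℒ a (k ∸ (i + j)) (∂ˢ (suc (suc i)) (ℒ b (i + j ∸ i) F))
        ≈⟨ ≡⇒≋ (≡.cong₂ (λ x y → ℒ a x (∂ˢ (suc (suc i)) (ℒ b y F))) (≡.sym (ℕₚ.∸-+-assoc k i j))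
                                                                     (ℕₚ.m+n∸m≡n i j)) ⟩
      ℒ a (k ∸ i ∸ j) (∂ˢ (suc (suc i)) (ℒ b j F))
        ≈⟨ ℒ-∂ˢ a (k ∸ i ∸ j) (suc (suc i)) (ℒ b j F) ⟩
      ∂ˢ (suc (suc i)) (ℒ a (k ∸ i ∸ j) (ℒ b j F)) ∎)

commutatorSum-comm : ∀ a b k F → commutatorSum a b k F ≋ commutatorSum b a k F
commutatorSum-comm a b k F = begin
  commutatorSum a b k F               ≈⟨ commutatorSum-closed a b k F ⟩
  ⟦ suc a * suc b ⟧ ·ˢ ℒ′ (a + b) k F  ≈⟨ ⟦⟧·ˢ-cong (ℕₚ.*-comm (suc a) (suc b)) (≡⇒≋ (≡.cong (λ n → ℒ′ n k F) (ℕₚ.+-comm a b))) ⟩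
  ⟦ suc b * suc a ⟧ ·ˢ ℒ′ (b + a) k F  ≈⟨ commutatorSum-closed b a k F ⟨
  commutatorSum b a k F               ∎
  where open SeriesReasoning

-- Grouping the tuples by their weight k = |is|. The statement allows any linear Φ in place of Qˢ so that the
-- induction step can absorb the first derivative ∂_{i+1} into Φ.
∑-tuples : ∀ {N G} → ConstantBeyond N G → ∀ n K L (Φ : ℕ → Series → Series) → (∀ k → IsLinear (Φ k)) →
           N ≤ K → n * K < L →
           ∑ (tuples n K) (λ is → ⟦ multinom is ⟧ ·ˢ Φ (sumℕ is) (∂vecˢ is G)) ≋ ∑< L (λ k → Φ k (ℒ n k G))
∑-tuples {N} {G} G-const zero K (suc L) Φ Φ-lin N≤K _ = begin
  ⟦ 1 ⟧ ·ˢ Φ 0 G +ˢ 0ˢ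
    ≈⟨ ≋-trans (+ˢ-identityʳ _) (⟦1⟧·ˢ (Φ 0 G)) ⟩
  Φ 0 G
    ≈⟨ ≋-trans (+ˢ-cong (≋-refl {Φ 0 G}) (∑<-zero L (λ k _ → 0-homo (Φ-lin (suc k))))) (+ˢ-identityʳ (Φ 0 G)) ⟨
  Φ 0 G +ˢ ∑< L (λ k → Φ (suc k) 0ˢ)
    ≈⟨ ∑<-suc L (λ k → Φ k (ℒ zero k G)) ⟨
  ∑< (suc L) (λ k → Φ k (ℒ zero k G)) ∎
  where open SeriesReasoning
∑-tuples {N} {G} G-const (suc n) K (suc L) Φ Φ-lin N≤K K+n*K<1+L = begin
  ∑ (concatMap (λ i → map (i ∷_) (tuples n K)) (upTo K)) Tm
    ≈⟨ ≋-trans (∑-concatMap _ (upTo K) Tm) (≋-trans (∑-cong (upTo K) (λ i → ∑-map (i ∷_) (tuples n K) Tm)) (∑-upTo K _)) ⟩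
  ∑< K (λ i → ∑ (tuples n K) (λ is → Tm (i ∷ is)))
    ≈⟨ ∑<-cong K (λ i → ≋-trans (∑-cong (tuples n K) (Tm-∷ i)) (∑-tuples G-const n K (suc L) (Ψ i) (Ψ-linear i) N≤K n*K<1+L)) ⟩
  ∑< K (λ i → ∑< (suc L) (λ j → Ψ i j (ℒ n j G)))
    ≈⟨ ∑<-support-box (λ i j → Ψ i j (ℒ n j G)) Ψ-vanishes₁ Ψ-vanishes₂ N≤K N+n*N<1+L ⟩
  ∑< (suc L) (λ i → ∑< (suc L ∸ i) (λ j → Ψ i j (ℒ n j G)))
    ≈⟨ ∑<-cong-< (suc L) reindex ⟨
  ∑< (suc L) (λ i → ∑< (suc (L ∸ i)) (λ j → g (i + j) i))
    ≈⟨ ∑<-triangle L g ⟨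
  ∑< (suc L) (λ k → ∑< (suc k) (g k))
    ≈⟨ ∑<-cong (suc L) (λ k → ∑<-·ˢ-linear (Φ-lin k) (suc k) (λ i → ⟦ k C i ⟧) (λ i → ∂ˢ (suc i) (ℒ n (k ∸ i) G))) ⟨
  ∑< (suc L) (λ k → Φ k (ℒ (suc n) k G)) ∎
  where
  open SeriesReasoning
  Tm : List ℕ → Series
  Tm is = ⟦ multinom is ⟧ ·ˢ Φ (sumℕ is) (∂vecˢ is G)
  Ψ : ℕ → ℕ → Series → Series
  Ψ i j X = ⟦ (i + j) C i ⟧ ·ˢ Φ (i + j) (∂ˢ (suc i) X)
  Ψ-linear : ∀ i j → IsLinear (Ψ i j)
  Ψ-linear i j = ∘-linear (·ˢ-linear ⟦ (i + j) C i ⟧) (∘-linear (Φ-lin (i + j)) (∂ˢ-linear (suc i)))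
  Tm-∷ : ∀ i is → Tm (i ∷ is) ≋ ⟦ multinom is ⟧ ·ˢ Ψ i (sumℕ is) (∂vecˢ is G)
  Tm-∷ i is = ≋-trans (⟦⟧·ˢ-cong (ℕₚ.*-comm ((i + sumℕ is) C i) (multinom is)) ≋-refl)
                      (≋-sym (⟦⟧·ˢ-assoc (multinom is) _ (Φ (i + sumℕ is) (∂ˢ (suc i) (∂vecˢ is G)))))
  g : ℕ → ℕ → Series
  g k i = ⟦ k C i ⟧ ·ˢ Φ k (∂ˢ (suc i) (ℒ n (k ∸ i) G))
  n*K<1+L : n * K < suc L
  n*K<1+L = ℕₚ.≤-<-trans (ℕₚ.m≤n+m (n * K) K) K+n*K<1+L
  N+n*N<1+L : N + n * N < suc L
  N+n*N<1+L = ℕₚ.≤-<-trans (ℕₚ.+-mono-≤ N≤K (ℕₚ.*-monoʳ-≤ n N≤K)) K+n*K<1+L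
  Ψ-vanishes₁ : ∀ i j → N ≤ i → Ψ i j (ℒ n j G) ≋ 0ˢ
  Ψ-vanishes₁ i j N≤i = linear-vanishes (∘-linear (·ˢ-linear ⟦ (i + j) C i ⟧) (Φ-lin (i + j))) (ℒ-constantBeyond n j G-const i N≤i)
  Ψ-vanishes₂ : ∀ i j → n * N < j → Ψ i j (ℒ n j G) ≋ 0ˢ
  Ψ-vanishes₂ i j n*N<j = linear-vanishes (Ψ-linear i j) (ℒ-vanishes G-const n j n*N<j)
  reindex : ∀ i → i < suc L → ∑< (suc (L ∸ i)) (λ j → g (i + j) i) ≋ ∑< (suc L ∸ i) (λ j → Ψ i j (ℒ n j G))
  reindex i (s≤s i≤L) rewrite ℕₚ.+-∸-assoc 1 i≤L =
    ∑<-cong (suc (L ∸ i)) λ j →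
      cong (Ψ-linear i j) (≡⇒≋ (≡.cong (λ x → ℒ n x G) (ℕₚ.m+n∸m≡n i j)))

-- Symmetry of 𝒟 n 𝒟 m

∑[ℒ,Q] : ℕ → ℕ → ℕ → ℕ → Series → Series
∑[ℒ,Q] n m k L F = ∑< L (λ l → [ℒ,Q] n k l (ℒ m l F))

∑[ℒ,Q]-zeroˡ : ∀ m k L F → ∑[ℒ,Q] zero m k L F ≋ 0ˢ
∑[ℒ,Q]-zeroˡ m k L F = ∑<-zero L λ _ _ → ≋-refl

∑[ℒ,Q]-zeroʳ : ∀ n k L F → ∑[ℒ,Q] n zero k L F ≋ 0ˢ
∑[ℒ,Q]-zeroʳ n k L F = ∑<-zero L λ l _ → term n l
  where
  term : ∀ n l → [ℒ,Q] n k l (ℒ zero l F) ≋ 0ˢ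
  term zero    l       = ≋-refl
  term (suc n) zero    = ≋-refl
  term (suc n) (suc l) = 0-homo ([ℒ,Q]-linear (suc n) k (suc l))

∑[ℒ,Q]≋commutatorSum : ∀ {N F} → ConstantBeyond N F → ∀ a b k L → suc b * N < suc L →
                       ∑[ℒ,Q] (suc a) (suc b) k (suc L) F ≋ commutatorSum a b k F
∑[ℒ,Q]≋commutatorSum {N} {F} F-const a b k L 1+b*N<1+L =
  ≋-trans (∑<-suc L _) (≋-trans (+ˢ-identityˡ _) (∑<-resize L (suc k) h beyond-L beyond-k))
  where
  h : ℕ → Series
  h j = ⟦ suc a * (k C j) ⟧ ·ˢ ℒ a (k ∸ j) (ℒ (suc b) (suc j) F)
  beyond-L : ∀ j → L ≤ j → h j ≋ 0ˢ
  beyond-L j L≤j = linear-vanishes (∘-linear (·ˢ-linear ⟦ suc a * (k C j) ⟧) (ℒ-linear a (k ∸ j)))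
                                   (ℒ-vanishes F-const (suc b) (suc j) (ℕₚ.≤-trans 1+b*N<1+L (s≤s L≤j)))
  beyond-k : ∀ j → suc k ≤ j → h j ≋ 0ˢ
  beyond-k j k<j = ⟦⟧·ˢ-zero _ (≡.trans (≡.cong (suc a *_) (k>n⇒nCk≡0 k<j)) (ℕₚ.*-zeroʳ (suc a)))

∑[ℒ,Q]-comm : ∀ {N F} → ConstantBeyond N F → ∀ n m k L → n * N < L → m * N < L → ∑[ℒ,Q] n m k L F ≋ ∑[ℒ,Q] m n k L F
∑[ℒ,Q]-comm {F = F} F-const zero    m       k L _ _ = ≋-trans (∑[ℒ,Q]-zeroˡ m k L F) (≋-sym (∑[ℒ,Q]-zeroʳ m k L F))
∑[ℒ,Q]-comm {F = F} F-const (suc a) zero    k L _ _ = ≋-trans (∑[ℒ,Q]-zeroʳ (suc a) k L F) (≋-sym (∑[ℒ,Q]-zeroˡ (suc a) k L F))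
∑[ℒ,Q]-comm F-const (suc a) (suc b) k (suc L) n*N<L m*N<L =
  ≋-trans (∑[ℒ,Q]≋commutatorSum F-const a b k L m*N<L)
          (≋-trans (commutatorSum-comm a b k _) (≋-sym (∑[ℒ,Q]≋commutatorSum F-const b a k L n*N<L)))

𝒟𝒟-double-sum : ℕ → ℕ → ℕ → Series → Series
𝒟𝒟-double-sum n m L F = ∑< L (λ k → ∑< L (λ l → Qˢ k (ℒ n k (Qˢ l (ℒ m l F)))))

coeffˢ-𝒟-expansion : ∀ n p L → n * bound p < L → coeffˢ (𝒟 n p) ≋ ∑< L (λ k → Qˢ k (ℒ n k (coeffˢ p)))
coeffˢ-𝒟-expansion n p L n*bound<L =
  ≋-trans (coeffˢ-𝒟 n p) (∑-tuples (coeffˢ-constantBeyond p) n (bound p) L Qˢ Qˢ-linear ℕₚ.≤-refl n*bound<L)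

coeffˢ-𝒟𝒟 : ∀ n m p L → m * bound p < L → n * bound (𝒟 m p) < L →
             coeffˢ (𝒟 n (𝒟 m p)) ≋ 𝒟𝒟-double-sum n m L (coeffˢ p)
coeffˢ-𝒟𝒟 n m p L m*bound<L n*bound′<L =
  ≋-trans (coeffˢ-𝒟-expansion n (𝒟 m p) L n*bound′<L) (∑<-cong L λ k →
    ≋-trans (cong (∘-linear (Qˢ-linear k) (ℒ-linear n k)) (coeffˢ-𝒟-expansion m p L m*bound<L))
            (∑<-linear (∘-linear (Qˢ-linear k) (ℒ-linear n k)) L _))

𝒟𝒟-double-sum-comm : ∀ {N F} → ConstantBeyond N F → ∀ n m L → n * N < L → m * N < L →
                     𝒟𝒟-double-sum n m L F ≋ 𝒟𝒟-double-sum m n L F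
𝒟𝒟-double-sum-comm {N} {F} F-const n m L n*N<L m*N<L = begin
  𝒟𝒟-double-sum n m L F
    ≈⟨ split n m ⟩
  ∑< L (λ k → ∑< L (QQℒℒ n m k)) +ˢ ∑< L (λ k → Qˢ k (∑[ℒ,Q] n m k L F))
    ≈⟨ +ˢ-cong (≋-trans (∑<-cong L (λ k → ∑<-cong L (QQℒℒ-comm k))) (∑<-comm L L (λ k l → QQℒℒ m n l k)))
               (∑<-cong L (λ k → cong (Qˢ-linear k) (∑[ℒ,Q]-comm F-const n m k L n*N<L m*N<L))) ⟩
  ∑< L (λ k → ∑< L (QQℒℒ m n k)) +ˢ ∑< L (λ k → Qˢ k (∑[ℒ,Q] m n k L F))
    ≈⟨ split m n ⟨
  𝒟𝒟-double-sum m n L F ∎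
  where
  open SeriesReasoning
  QQℒℒ : ℕ → ℕ → ℕ → ℕ → Series
  QQℒℒ n m k l = Qˢ k (Qˢ l (ℒ n k (ℒ m l F)))
  QQℒℒ-comm : ∀ k l → QQℒℒ n m k l ≋ QQℒℒ m n l k
  QQℒℒ-comm k l = ≋-trans (Qˢ-comm k l _) (cong (∘-linear (Qˢ-linear l) (Qˢ-linear k)) (ℒ-ℒ n k m l F))
  row : ∀ n m k → ∑< L (λ l → Qˢ k (ℒ n k (Qˢ l (ℒ m l F)))) ≋ ∑< L (QQℒℒ n m k) +ˢ Qˢ k (∑[ℒ,Q] n m k L F)
  row n m k = begin
    ∑< L (λ l → Qˢ k (ℒ n k (Qˢ l (ℒ m l F))))
      ≈⟨ ∑<-cong L (λ l → cong (Qˢ-linear k) (ℒ-Qˢ n k l (ℒ m l F))) ⟩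
    ∑< L (λ l → Qˢ k (QQℒℒ′ l +ˢ [ℒ,Q] n k l (ℒ m l F)))
      ≈⟨ ∑<-cong L (λ l → +-homo (Qˢ-linear k) (QQℒℒ′ l) ([ℒ,Q] n k l (ℒ m l F))) ⟩
    ∑< L (λ l → QQℒℒ n m k l +ˢ Qˢ k ([ℒ,Q] n k l (ℒ m l F)))
      ≈⟨ ∑<-distrib L (QQℒℒ n m k) (λ l → Qˢ k ([ℒ,Q] n k l (ℒ m l F))) ⟩
    ∑< L (QQℒℒ n m k) +ˢ ∑< L (λ l → Qˢ k ([ℒ,Q] n k l (ℒ m l F)))
      ≈⟨ +ˢ-cong (≋-refl {∑< L (QQℒℒ n m k)}) (∑<-linear (Qˢ-linear k) L (λ l → [ℒ,Q] n k l (ℒ m l F))) ⟨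
    ∑< L (QQℒℒ n m k) +ˢ Qˢ k (∑[ℒ,Q] n m k L F) ∎
    where
    QQℒℒ′ : ℕ → Series
    QQℒℒ′ l = Qˢ l (ℒ n k (ℒ m l F))
  split : ∀ n m → 𝒟𝒟-double-sum n m L F ≋ ∑< L (λ k → ∑< L (QQℒℒ n m k)) +ˢ ∑< L (λ k → Qˢ k (∑[ℒ,Q] n m k L F))
  split n m = ≋-trans (∑<-cong L (row n m)) (∑<-distrib L _ _)

lemma4p11 : (n m : ℕ) (p : Poly) → 𝒟 n (𝒟 m p) ≈ 𝒟 m (𝒟 n p)
lemma4p11 n m p = at≡ (begin
  coeffˢ (𝒟 n (𝒟 m p))
    ≈⟨ coeffˢ-𝒟𝒟 n m p L (bounded m≤n+m N₀≤B) (bounded n≤n+m N₁≤B) ⟩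
  𝒟𝒟-double-sum n m L (coeffˢ p)
    ≈⟨ 𝒟𝒟-double-sum-comm (coeffˢ-constantBeyond p) n m L (bounded n≤n+m N₀≤B) (bounded m≤n+m N₀≤B) ⟩
  𝒟𝒟-double-sum m n L (coeffˢ p)
    ≈⟨ coeffˢ-𝒟𝒟 m n p L (bounded n≤n+m N₀≤B) (bounded m≤n+m N₂≤B) ⟨
  coeffˢ (𝒟 m (𝒟 n p)) ∎)
  where
  open SeriesReasoning
  N₀ N₁ N₂ B L : ℕ
  N₀ = bound p
  N₁ = bound (𝒟 m p)
  N₂ = bound (𝒟 n p)
  B  = N₀ + N₁ + N₂
  L  = suc ((n + m) * B)
  bounded : ∀ {a x} → a ≤ n + m → x ≤ B → a * x < L
  bounded a≤n+m x≤B = s≤s (ℕₚ.*-mono-≤ a≤n+m x≤B)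
  n≤n+m : n ≤ n + m
  n≤n+m = ℕₚ.m≤m+n n m
  m≤n+m : m ≤ n + m
  m≤n+m = ℕₚ.m≤n+m m n
  N₀≤B : N₀ ≤ B
  N₀≤B = ℕₚ.≤-trans (ℕₚ.m≤m+n N₀ N₁) (ℕₚ.m≤m+n (N₀ + N₁) N₂)
  N₁≤B : N₁ ≤ B
  N₁≤B = ℕₚ.≤-trans (ℕₚ.m≤n+m N₁ N₀) (ℕₚ.m≤m+n (N₀ + N₁) N₂)
  N₂≤B : N₂ ≤ B
  N₂≤B = ℕₚ.m≤n+m N₂ (N₀ + N₁)
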